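{- Let $G$ be a graph and $m\ge1$ an integer. Then $G$ is integral if and only if its $m$-duplicate graph $D^m(G)$ is integral.
   Context: All graphs are finite, simple and undirected. A graph is integral if all eigenvalues of its adjacency matrix are integers. The duplicate graph $D(G)$ of $G=(V,E)$ has vertex set $V\cup V'$, where $V'=\{a':a\in V\}$ is a disjoint copy of $V$, and for each edge $ab\in E$ it has the edges $ab'$ and $a'b$ (and no others); the $m$-duplicate graph is $D^1(G)=D(G)$, $D^m(G)=D^{m-1}(D(G))$. -}

module Defs where

open import Data.Nat using (ℕ; zero; suc; _+_)
open import Data.Fin using (Fin; zero; suc; punchIn; splitAt; _≟_)
open import Data.Bool using (Bool; true; false; if_then_else_)
open import Data.Sum using (_⊎_; inj₁; inj₂)
open import Data.Integer using (ℤ; +_; -_; _-_; _*_) renaming (_+_ to _+ℤ_)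
open import Data.Product using (∃)
open import Relation.Nullary using (yes; no)
open import Relation.Binary.PropositionalEquality using (_≡_; refl)

record Graph (n : ℕ) : Set where
  field
    adj    : Fin n → Fin n → Bool
    sym    : ∀ i j → adj i j ≡ adj j i
    irrefl : ∀ i → adj i i ≡ false
open Graph public

-- Duplicate graph: vertices Fin (n + n) = V ⊎ V' via splitAt;
-- edges a b' and a' b for every edge ab of G, and no others.
dupAdj : ∀ {n} → Graph n → Fin n ⊎ Fin n → Fin n ⊎ Fin n → Bool
dupAdj G (inj₁ a) (inj₂ b) = adj G a b
dupAdj G (inj₂ a) (inj₁ b) = adj G a b
dupAdj G (inj₁ a) (inj₁ b) = false
dupAdj G (inj₂ a) (inj₂ b) = false

dupAdj-sym : ∀ {n} (G : Graph n) x y → dupAdj G x y ≡ dupAdj G y x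
dupAdj-sym G (inj₁ a) (inj₁ b) = refl
dupAdj-sym G (inj₁ a) (inj₂ b) = sym G a b
dupAdj-sym G (inj₂ a) (inj₁ b) = sym G a b
dupAdj-sym G (inj₂ a) (inj₂ b) = refl

dupAdj-irr : ∀ {n} (G : Graph n) x → dupAdj G x x ≡ false
dupAdj-irr G (inj₁ a) = refl
dupAdj-irr G (inj₂ a) = refl

D : ∀ {n} → Graph n → Graph (n + n)
D {n} G = record
  { adj    = λ i j → dupAdj G (splitAt n i) (splitAt n j)
  ; sym    = λ i j → dupAdj-sym G (splitAt n i) (splitAt n j)
  ; irrefl = λ i → dupAdj-irr G (splitAt n i)
  }

dupSize : ℕ → ℕ → ℕ
dupSize zero    n = n
dupSize (suc m) n = dupSize m (n + n)

Dᵐ : ∀ {n} (m : ℕ) → Graph n → Graph (dupSize m n)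
Dᵐ zero    G = G
Dᵐ (suc m) G = Dᵐ m (D G)

sumFin : ∀ n → (Fin n → ℤ) → ℤ
sumFin zero    f = + 0
sumFin (suc n) f = f zero +ℤ sumFin n (λ i → f (suc i))

prodFin : ∀ n → (Fin n → ℤ) → ℤ
prodFin zero    f = + 1
prodFin (suc n) f = f zero * prodFin n (λ i → f (suc i))

sign : ∀ {n} → Fin n → ℤ
sign zero    = + 1
sign (suc j) = - sign j

det : ∀ n → (Fin n → Fin n → ℤ) → ℤ
det zero    M = + 1
det (suc n) M =
  sumFin (suc n) (λ j → sign j * (M zero j * det n (λ i k → M (suc i) (punchIn j k))))

A : ∀ {n} → Graph n → Fin n → Fin n → ℤ
A G i j = if adj G i j then + 1 else + 0

charPoly : ∀ {n} → Graph n → ℤ → ℤ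
charPoly {n} G t = det n (λ i j → δ i j - A G i j)
  where
  δ : Fin n → Fin n → ℤ
  δ i j with i ≟ j
  ... | yes _ = t
  ... | no  _ = + 0

-- G is integral: all eigenvalues (roots of the characteristic polynomial, with
-- multiplicity) are integers, i.e. det(tI - A) = ∏ᵢ (t - λᵢ) with λᵢ ∈ ℤ.
Integral : ∀ {n} → Graph n → Set
Integral {n} G = ∃ λ (ev : Fin n → ℤ) → ∀ t → charPoly G t ≡ prodFin n (λ i → t - ev i)

{-# OPTIONS --safe #-}
module Submission where

-- The adjacency matrix of D(G) is [ 0 A ; A 0 ]. Conjugating tI - A(D G) by the block shear
-- [ I I ; 0 I ] makes it block-triangular, so det(tI - A(D G)) = det(tI - A) · det(tI + A), which is
-- χ(t) · (-1)ⁿ χ(-t): the eigenvalues of D(G) are those of G together with their negatives, and D(G)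
-- is integral when G is. Conversely, if the product of the monic polynomials χ(t) and (-1)ⁿ χ(-t)
-- splits into integer linear factors, so does χ: a root of the product is a root of one factor,
-- and it can be divided out because a polynomial function on ℤ is determined by its values away
-- from a single point. Iterating gives the result for D^m(G). The multiplicativity of the
-- determinant, defined by Laplace expansion, comes from the uniqueness of alternating multilinear forms.

open import Defs hiding (sym)
open import Data.Nat using (ℕ; zero; suc; _≤_; _<_; s≤s) renaming (_+_ to _+ℕ_)
import Data.Nat.Properties as ℕ
open import Data.Integer
  using (ℤ; +_; -_; _-_; _*_; _+_; _^_; ∣_∣; +[1+_]; -[1+_]; -1ℤ)
open import Data.Integer.Properties
  using ( +-identityˡ; +-identityʳ; +-assoc; +-comm; +-inverseˡ; +-inverseʳ; *-identityˡ; *-identityʳ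
        ; *-zeroˡ; *-zeroʳ; *-assoc; *-comm; *-distribˡ-+; neg-distrib-+
        ; i*j≡0⇒i≡0∨j≡0; i-j≡0⇒i≡j; +-commutativeSemigroup)
open import Algebra.Properties.CommutativeSemigroup +-commutativeSemigroup
  using (interchange; x∙yz≈y∙xz)
open import Data.Integer.Tactic.RingSolver using (solve-∀)
open import Data.Fin
  using (Fin; zero; suc; _≟_; punchIn; punchOut; _↑ˡ_; _↑ʳ_; splitAt; inject₁; join)
open import Data.Fin.Properties
  using ( suc-injective; punchInᵢ≢i; punchIn-injective; punchIn-punchOut; punchOut-punchIn
        ; punchOut-cong; splitAt-↑ˡ; splitAt-↑ʳ; join-splitAt)
open import Data.Fin.Induction using (<-weakInduction)
open import Data.Vec.Functional using (_∷_; tail; _++_)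
open import Data.Bool using (if_then_else_)
open import Data.Sum using (_⊎_; inj₁; inj₂; [_,_])
open import Data.Product using (∃; Σ; _×_; _,_; proj₂)
open import Data.Empty using (⊥-elim)
open import Function using (_∘_)
open import Function.Bundles using (_⇔_; mk⇔)
open import Function.Properties.Equivalence using () renaming (refl to ⇔-refl; trans to ⇔-trans)
open import Relation.Nullary using (yes; no; Dec)
open import Relation.Binary.PropositionalEquality
  using (_≡_; _≢_; refl; sym; trans; cong; cong₂; module ≡-Reasoning)

sumFin-cong : ∀ n {f g : Fin n → ℤ} → (∀ i → f i ≡ g i) → sumFin n f ≡ sumFin n g
sumFin-cong zero    f≗g = refl
sumFin-cong (suc n) f≗g = cong₂ _+_ (f≗g zero) (sumFin-cong n (f≗g ∘ suc))

sumFin-zero : ∀ n {f : Fin n → ℤ} → (∀ i → f i ≡ + 0) → sumFin n f ≡ + 0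
sumFin-zero zero    f≗0 = refl
sumFin-zero (suc n) f≗0 = cong₂ _+_ (f≗0 zero) (sumFin-zero n (f≗0 ∘ suc))

sumFin-+ : ∀ n (f g : Fin n → ℤ) → sumFin n (λ i → f i + g i) ≡ sumFin n f + sumFin n g
sumFin-+ zero    f g = refl
sumFin-+ (suc n) f g = trans (cong (_+_ (f zero + g zero)) (sumFin-+ n (f ∘ suc) (g ∘ suc)))
                             (interchange (f zero) (g zero) _ _)

*-distribˡ-sumFin : ∀ n c (f : Fin n → ℤ) → c * sumFin n f ≡ sumFin n (λ i → c * f i)
*-distribˡ-sumFin zero    c f = *-zeroʳ c
*-distribˡ-sumFin (suc n) c f = trans (*-distribˡ-+ c (f zero) _)
                                      (cong (_+_ (c * f zero)) (*-distribˡ-sumFin n c (f ∘ suc)))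

neg-distrib-sumFin : ∀ n (f : Fin n → ℤ) → - sumFin n f ≡ sumFin n (λ i → - f i)
neg-distrib-sumFin zero    f = refl
neg-distrib-sumFin (suc n) f = trans (neg-distrib-+ (f zero) _)
                                     (cong (_+_ (- f zero)) (neg-distrib-sumFin n (f ∘ suc)))

sumFin-linear : ∀ n c {f g h : Fin n → ℤ} → (∀ i → f i ≡ c * g i + h i) →
                sumFin n f ≡ c * sumFin n g + sumFin n h
sumFin-linear n c {f} {g} {h} f≗cg+h = begin
  sumFin n f                                  ≡⟨ sumFin-cong n f≗cg+h ⟩
  sumFin n (λ i → c * g i + h i)              ≡⟨ sumFin-+ n _ h ⟩
  sumFin n (λ i → c * g i) + sumFin n h       ≡⟨ cong (_+ sumFin n h) (*-distribˡ-sumFin n c g) ⟨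
  c * sumFin n g + sumFin n h                 ∎
  where open ≡-Reasoning

sumFin-punchIn : ∀ n (j : Fin (suc n)) (f : Fin (suc n) → ℤ) →
                 sumFin (suc n) f ≡ f j + sumFin n (f ∘ punchIn j)
sumFin-punchIn n       zero    f = refl
sumFin-punchIn (suc n) (suc j) f = trans (cong (_+_ (f zero)) (sumFin-punchIn n j (f ∘ suc)))
                                         (x∙yz≈y∙xz (f zero) (f (suc j)) _)

sumFin-comm : ∀ m n (f : Fin m → Fin n → ℤ) →
              sumFin m (λ i → sumFin n (f i)) ≡ sumFin n (λ j → sumFin m (λ i → f i j))
sumFin-comm zero    n f = sym (sumFin-zero n (λ _ → refl))
sumFin-comm (suc m) n f = trans (cong (_+_ (sumFin n (f zero))) (sumFin-comm m n (f ∘ suc)))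
                                (sym (sumFin-+ n (f zero) _))

sumFin-↑ : ∀ a b (f : Fin (a +ℕ b) → ℤ) →
           sumFin (a +ℕ b) f ≡ sumFin a (λ i → f (i ↑ˡ b)) + sumFin b (λ i → f (a ↑ʳ i))
sumFin-↑ zero    b f = sym (+-identityˡ _)
sumFin-↑ (suc a) b f = trans (cong (_+_ (f zero)) (sumFin-↑ a b (f ∘ suc))) (sym (+-assoc (f zero) _ _))

prodFin-cong : ∀ n {f g : Fin n → ℤ} → (∀ i → f i ≡ g i) → prodFin n f ≡ prodFin n g
prodFin-cong zero    f≗g = refl
prodFin-cong (suc n) f≗g = cong₂ _*_ (f≗g zero) (prodFin-cong n (f≗g ∘ suc))

prodFin-↑ : ∀ a b (f : Fin (a +ℕ b) → ℤ) →
            prodFin (a +ℕ b) f ≡ prodFin a (λ i → f (i ↑ˡ b)) * prodFin b (λ i → f (a ↑ʳ i))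
prodFin-↑ zero    b f = sym (*-identityˡ _)
prodFin-↑ (suc a) b f = trans (cong (f zero *_) (prodFin-↑ a b (f ∘ suc))) (sym (*-assoc (f zero) _ _))

Matrix : ℕ → Set
Matrix n = Fin n → Fin n → ℤ

infix 4 _≗ᴹ_
_≗ᴹ_ : ∀ {n} → Matrix n → Matrix n → Set
M ≗ᴹ N = ∀ i k → M i k ≡ N i k

scalar : ∀ {n} → ℤ → Matrix n
scalar t i j with i ≟ j
... | yes _ = t
... | no  _ = + 0

I : ∀ {n} → Matrix n
I = scalar (+ 1)

scalar-diag : ∀ {n} t (i : Fin n) → scalar t i i ≡ t
scalar-diag t i with i ≟ i
... | yes _  = refl
... | no i≢i = ⊥-elim (i≢i refl)

scalar-offDiag : ∀ {n} t {i j : Fin n} → i ≢ j → scalar t i j ≡ + 0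
scalar-offDiag t {i} {j} i≢j with i ≟ j
... | yes i≡j = ⊥-elim (i≢j i≡j)
... | no  _   = refl

scalar-suc : ∀ {n} t (i j : Fin n) → scalar t (suc i) (suc j) ≡ scalar t i j
scalar-suc t i j with i ≟ j
... | yes refl = refl
... | no  _    = refl

scalar-neg : ∀ {n} t (i j : Fin n) → scalar (- t) i j ≡ - scalar t i j
scalar-neg t i j with i ≟ j
... | yes _ = refl
... | no  _ = refl

sumFin-I-selectˡ : ∀ n (i : Fin n) (f : Fin n → ℤ) → sumFin n (λ l → I i l * f l) ≡ f i
sumFin-I-selectˡ (suc n) i f = begin
  sumFin (suc n) (λ l → I i l * f l)                       ≡⟨ sumFin-punchIn n i (λ l → I i l * f l) ⟩
  I i i * f i + sumFin n (λ k → I i (punchIn i k) * f (punchIn i k))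
    ≡⟨ cong₂ _+_ (cong (_* f i) (scalar-diag (+ 1) i))
                 (sumFin-zero n (λ k → cong (_* f (punchIn i k))
                                            (scalar-offDiag (+ 1) (punchInᵢ≢i i k ∘ sym)))) ⟩
  + 1 * f i + + 0                                          ≡⟨ +-identityʳ _ ⟩
  + 1 * f i                                                ≡⟨ *-identityˡ (f i) ⟩
  f i                                                      ∎
  where open ≡-Reasoning

scalar-sym : ∀ {n} t (i j : Fin n) → scalar t i j ≡ scalar t j i
scalar-sym t i j with i ≟ j | j ≟ i
... | yes _   | yes _   = refl
... | no  _   | no  _   = refl
... | yes i≡j | no  j≢i = ⊥-elim (j≢i (sym i≡j))
... | no  i≢j | yes j≡i = ⊥-elim (i≢j (sym j≡i))

sumFin-I-selectʳ : ∀ n (i : Fin n) (f : Fin n → ℤ) → sumFin n (λ l → f l * I l i) ≡ f i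
sumFin-I-selectʳ n i f = trans (sumFin-cong n (λ l → trans (*-comm (f l) (I l i))
                                                          (cong (_* f l) (scalar-sym (+ 1) l i))))
                               (sumFin-I-selectˡ n i f)

infixl 7 _*ᴹ_
_*ᴹ_ : ∀ {n} → Matrix n → Matrix n → Matrix n
_*ᴹ_ {n} M N i k = sumFin n (λ l → M i l * N l k)

minor : ∀ {n} → Matrix (suc n) → Fin (suc n) → Matrix n
minor M j i k = M (suc i) (punchIn j k)

expansionTerm : ∀ {n} → Matrix (suc n) → Fin (suc n) → ℤ
expansionTerm {n} M j = sign j * (M zero j * det n (minor M j))

det-cong : ∀ n {M N : Matrix n} → M ≗ᴹ N → det n M ≡ det n N
det-cong zero    M≗N = refl
det-cong (suc n) M≗N = sumFin-cong (suc n) λ j →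
  cong₂ (λ x d → sign j * (x * d)) (M≗N zero j) (det-cong n (λ i k → M≗N (suc i) (punchIn j k)))

AgreeOffRow : ∀ {n} → Fin n → Matrix n → Matrix n → Set
AgreeOffRow r M N = ∀ i → i ≢ r → ∀ k → M i k ≡ N i k

zero≢suc : ∀ {n} {r : Fin n} → Fin.zero ≢ suc r
zero≢suc ()

det-linear : ∀ n r c {M M₁ M₂ : Matrix n} → AgreeOffRow r M M₁ → AgreeOffRow r M M₂ →
             (∀ k → M r k ≡ c * M₁ r k + M₂ r k) → det n M ≡ c * det n M₁ + det n M₂
det-linear (suc n) zero c {M} {M₁} {M₂} M≈M₁ M≈M₂ row = sumFin-linear (suc n) c λ j →
  begin
    sign j * (M zero j * det n (minor M j))
      ≡⟨ cong (λ x → sign j * (x * det n (minor M j))) (row j) ⟩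
    sign j * ((c * M₁ zero j + M₂ zero j) * det n (minor M j))
      ≡⟨ distrib c (sign j) (M₁ zero j) (M₂ zero j) (det n (minor M j)) ⟩
    c * (sign j * (M₁ zero j * det n (minor M j))) + sign j * (M₂ zero j * det n (minor M j))
      ≡⟨ cong₂ (λ d₁ d₂ → c * (sign j * (M₁ zero j * d₁)) + sign j * (M₂ zero j * d₂))
               (det-cong n (λ i k → M≈M₁ (suc i) (λ ()) (punchIn j k)))
               (det-cong n (λ i k → M≈M₂ (suc i) (λ ()) (punchIn j k))) ⟩
    c * expansionTerm M₁ j + expansionTerm M₂ j
  ∎
  where
  open ≡-Reasoning
  distrib : ∀ c s x y d → s * ((c * x + y) * d) ≡ c * (s * (x * d)) + s * (y * d)
  distrib = solve-∀
det-linear (suc n) (suc r) c {M} {M₁} {M₂} M≈M₁ M≈M₂ row = sumFin-linear (suc n) c λ j →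
  begin
    sign j * (M zero j * det n (minor M j))
      ≡⟨ cong (λ d → sign j * (M zero j * d))
              (det-linear n r c (λ i i≢r k → M≈M₁ (suc i) (i≢r ∘ suc-injective) (punchIn j k))
                                (λ i i≢r k → M≈M₂ (suc i) (i≢r ∘ suc-injective) (punchIn j k))
                                (row ∘ punchIn j)) ⟩
    sign j * (M zero j * (c * det n (minor M₁ j) + det n (minor M₂ j)))
      ≡⟨ distrib c (sign j) (M zero j) (det n (minor M₁ j)) (det n (minor M₂ j)) ⟩
    c * (sign j * (M zero j * det n (minor M₁ j))) + sign j * (M zero j * det n (minor M₂ j))
      ≡⟨ cong₂ (λ x₁ x₂ → c * (sign j * (x₁ * det n (minor M₁ j))) + sign j * (x₂ * det n (minor M₂ j)))
               (M≈M₁ zero zero≢suc j) (M≈M₂ zero zero≢suc j) ⟩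
    c * expansionTerm M₁ j + expansionTerm M₂ j
  ∎
  where
  open ≡-Reasoning
  distrib : ∀ c s x d₁ d₂ → s * (x * (c * d₁ + d₂)) ≡ c * (s * (x * d₁)) + s * (x * d₂)
  distrib = solve-∀

record IsMultilinear {n} (f : Matrix n → ℤ) : Set where
  field
    respects-≗ᴹ : ∀ {M N} → M ≗ᴹ N → f M ≡ f N
    linear      : ∀ r c {M M₁ M₂} → AgreeOffRow r M M₁ → AgreeOffRow r M M₂ →
                  (∀ k → M r k ≡ c * M₁ r k + M₂ r k) → f M ≡ c * f M₁ + f M₂

AlternatingAt : ∀ {n} → (Matrix n → ℤ) → Fin n → Fin n → Set
AlternatingAt {n} f a b = ∀ (M : Matrix n) → (∀ k → M a k ≡ M b k) → f M ≡ + 0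

Alternating : ∀ {n} → (Matrix n → ℤ) → Set
Alternating f = ∀ {a b} → a ≢ b → AlternatingAt f a b

det-isMultilinear : ∀ n → IsMultilinear (det n)
det-isMultilinear n = record { respects-≗ᴹ = det-cong n ; linear = det-linear n }

setRow : ∀ {n} → Matrix n → Fin n → (Fin n → ℤ) → Matrix n
setRow M r v i k with i ≟ r
... | yes _ = v k
... | no  _ = M i k

setRow-same : ∀ {n} (M : Matrix n) r v k → setRow M r v r k ≡ v k
setRow-same M r v k with r ≟ r
... | yes _   = refl
... | no  r≢r = ⊥-elim (r≢r refl)

setRow-other : ∀ {n} (M : Matrix n) {r} v {i} k → i ≢ r → setRow M r v i k ≡ M i k
setRow-other M {r} v {i} k i≢r with i ≟ r
... | yes i≡r = ⊥-elim (i≢r i≡r)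
... | no  _   = refl

setRow-agrees : ∀ {n} (M : Matrix n) r v → AgreeOffRow r M (setRow M r v)
setRow-agrees M r v i i≢r k = sym (setRow-other M v k i≢r)

setRow-setRow : ∀ {n} (M : Matrix n) r u v → setRow (setRow M r u) r v ≗ᴹ setRow M r v
setRow-setRow M r u v i k with i ≟ r
... | yes _   = refl
... | no  i≢r = setRow-other M u k i≢r

setRow₂-unique : ∀ {n} {M N : Matrix n} {a b} u v → (∀ k → N a k ≡ u k) → (∀ k → N b k ≡ v k) →
                 (∀ i → i ≢ a → i ≢ b → ∀ k → N i k ≡ M i k) → setRow (setRow M a u) b v ≗ᴹ N
setRow₂-unique {a = a} {b} u v Na Nb N-other i k with i ≟ b
... | yes refl = sym (Nb k)
... | no  i≢b with i ≟ a
...   | yes refl = sym (Na k)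
...   | no  i≢a  = sym (N-other i i≢a i≢b k)

module MultilinearProperties {n} {f : Matrix n → ℤ} (f-multilinear : IsMultilinear f) where
  open IsMultilinear f-multilinear

  additive : ∀ r {M M₁ M₂} → AgreeOffRow r M M₁ → AgreeOffRow r M M₂ →
             (∀ k → M r k ≡ M₁ r k + M₂ r k) → f M ≡ f M₁ + f M₂
  additive r {M} {M₁} {M₂} M≈M₁ M≈M₂ row =
    trans (linear r (+ 1) M≈M₁ M≈M₂ (λ k → trans (row k) (cong (_+ M₂ r k) (sym (*-identityˡ (M₁ r k))))))
          (cong (_+ f M₂) (*-identityˡ (f M₁)))

  zero-row : ∀ r {M} → (∀ k → M r k ≡ + 0) → f M ≡ + 0
  zero-row r {M} M-r≡0 =
    trans (linear r -1ℤ (λ _ _ _ → refl) (λ _ _ _ → refl) (λ k → trans (M-r≡0 k) (cancel (M r k))))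
          (sym (cancel (f M)))
    where
    cancel : ∀ x → + 0 ≡ -1ℤ * x + x
    cancel = solve-∀

  row-expansion : ∀ K r (w : Fin K → ℤ) (v : Fin K → Fin n → ℤ) {M} →
                  (∀ k → M r k ≡ sumFin K (λ l → w l * v l k)) →
                  f M ≡ sumFin K (λ l → w l * f (setRow M r (v l)))
  row-expansion zero    r w v row = zero-row r row
  row-expansion (suc K) r w v {M} row =
    trans (linear r (w zero) (setRow-agrees M r (v zero)) (setRow-agrees M r rest)
                  (λ k → trans (row k) (sym (cong₂ (λ x y → w zero * x + y)
                                                   (setRow-same M r (v zero) k) (setRow-same M r rest k)))))
          (cong (_+_ (w zero * f (setRow M r (v zero))))
                (trans (row-expansion K r (w ∘ suc) (v ∘ suc) (setRow-same M r rest))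
                       (sumFin-cong K (λ l → cong (w (suc l) *_)
                                                  (respects-≗ᴹ (setRow-setRow M r rest (v (suc l))))))))
    where
    rest : Fin n → ℤ
    rest k = sumFin K (λ l → w (suc l) * v (suc l) k)

  add-multiple-of-row : ∀ {r s} → r ≢ s → AlternatingAt f r s → ∀ c {M N} → AgreeOffRow r N M →
                        (∀ k → N r k ≡ M r k + c * M s k) → f N ≡ f M
  add-multiple-of-row {r} {s} r≢s alt c {M} {N} N≈M row = begin
    f N               ≡⟨ linear r c N≈M′ N≈M row′ ⟩
    c * f M′ + f M    ≡⟨ cong (λ x → c * x + f M) (alt M′ M′-rows) ⟩
    c * + 0 + f M     ≡⟨ cong (_+ f M) (*-zeroʳ c) ⟩
    + 0 + f M         ≡⟨ +-identityˡ (f M) ⟩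
    f M               ∎
    where
    open ≡-Reasoning
    M′ : Matrix n
    M′ = setRow M r (M s)
    N≈M′ : AgreeOffRow r N M′
    N≈M′ i i≢r k = trans (N≈M i i≢r k) (setRow-agrees M r (M s) i i≢r k)
    row′ : ∀ k → N r k ≡ c * M′ r k + M r k
    row′ k = trans (row k) (trans (+-comm (M r k) (c * M s k)) (cong (λ x → c * x + M r k) (sym (setRow-same M r (M s) k))))
    M′-rows : ∀ k → M′ r k ≡ M′ s k
    M′-rows k = trans (setRow-same M r (M s) k) (sym (setRow-other M (M s) k (r≢s ∘ sym)))

  swap-rows : ∀ {a b} → a ≢ b → AlternatingAt f a b → ∀ {M N} →
              (∀ k → N a k ≡ M b k) → (∀ k → N b k ≡ M a k) →
              (∀ i → i ≢ a → i ≢ b → ∀ k → N i k ≡ M i k) → f N ≡ - f M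
  swap-rows {a} {b} a≢b alt {M} {N} Na Nb N-other =
    trans (respects-≗ᴹ (λ i k → sym (setRow₂-unique q p Na Nb N-other i k)))
          (trans (0≡x+y⇒y≡-x (f (R p q)) (f (R q p)) key)
                 (cong -_ (respects-≗ᴹ (setRow₂-unique p q (λ _ → refl) (λ _ → refl) (λ _ _ _ _ → refl)))))
    where
    R : (Fin n → ℤ) → (Fin n → ℤ) → Matrix n
    R u v = setRow (setRow M a u) b v
    p q p+q : Fin n → ℤ
    p = M a
    q = M b
    p+q k = p k + q k
    R-a : ∀ u v k → R u v a k ≡ u k
    R-a u v k = trans (setRow-other _ v k a≢b) (setRow-same M a u k)
    R-b : ∀ u v k → R u v b k ≡ v k
    R-b u v k = setRow-same _ b v k
    R-agree-a : ∀ u u' v → AgreeOffRow a (R u v) (R u' v)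
    R-agree-a u u' v i i≢a k with i ≟ b
    ... | yes _ = refl
    ... | no  _ = trans (setRow-other M u k i≢a) (sym (setRow-other M u' k i≢a))
    R-agree-b : ∀ u v v' → AgreeOffRow b (R u v) (R u v')
    R-agree-b u v v' i i≢b k = trans (setRow-other _ v k i≢b) (sym (setRow-other _ v' k i≢b))
    R-same : ∀ u → f (R u u) ≡ + 0
    R-same u = alt _ (λ k → trans (R-a u u k) (sym (R-b u u k)))
    additive-a : ∀ u v w → f (R (λ k → u k + v k) w) ≡ f (R u w) + f (R v w)
    additive-a u v w = additive a (R-agree-a _ u w) (R-agree-a _ v w)
                         (λ k → trans (R-a _ w k) (sym (cong₂ _+_ (R-a u w k) (R-a v w k))))
    additive-b : ∀ u v w → f (R w (λ k → u k + v k)) ≡ f (R w u) + f (R w v)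
    additive-b u v w = additive b (R-agree-b w _ u) (R-agree-b w _ v)
                         (λ k → trans (R-b w _ k) (sym (cong₂ _+_ (R-b w u k) (R-b w v k))))
    key : + 0 ≡ f (R p q) + f (R q p)
    key = begin
      + 0                                                   ≡⟨ R-same p+q ⟨
      f (R p+q p+q)                                         ≡⟨ additive-a p q p+q ⟩
      f (R p p+q) + f (R q p+q)                             ≡⟨ cong₂ _+_ (additive-b p q p) (additive-b p q q) ⟩
      (f (R p p) + f (R p q)) + (f (R q p) + f (R q q))     ≡⟨ cong₂ (λ x y → (x + f (R p q)) + (f (R q p) + y))
                                                                     (R-same p) (R-same q) ⟩
      (+ 0 + f (R p q)) + (f (R q p) + + 0)                 ≡⟨ drop-zeros (f (R p q)) (f (R q p)) ⟩
      f (R p q) + f (R q p)                                 ∎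
      where
      open ≡-Reasoning
      drop-zeros : ∀ x y → (+ 0 + x) + (y + + 0) ≡ x + y
      drop-zeros = solve-∀
    0≡x+y⇒y≡-x : ∀ x y → + 0 ≡ x + y → y ≡ - x
    0≡x+y⇒y≡-x x y 0≡x+y = trans (solve-y x y) (trans (cong (_+_ (- x)) (sym 0≡x+y)) (+-identityʳ (- x)))
      where
      solve-y : ∀ x y → y ≡ - x + (x + y)
      solve-y = solve-∀

-- The determinant is alternating

x≡-x⇒x≡0 : ∀ {x : ℤ} → x ≡ - x → x ≡ + 0
x≡-x⇒x≡0 {+ zero}    _  = refl
x≡-x⇒x≡0 {+[1+ _ ]} ()
x≡-x⇒x≡0 { -[1+ _ ]} ()

sumFin-antisymmetric : ∀ n (G : Fin n → Fin n → ℤ) → (∀ a b → G a b ≡ - G b a) →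
                       sumFin n (λ a → sumFin n (G a)) ≡ + 0
sumFin-antisymmetric n G anti = x≡-x⇒x≡0 (begin
  sumFin n (λ a → sumFin n (G a))               ≡⟨ sumFin-comm n n G ⟩
  sumFin n (λ b → sumFin n (λ a → G a b))       ≡⟨ sumFin-cong n (λ b → sumFin-cong n (λ a → anti a b)) ⟩
  sumFin n (λ b → sumFin n (λ a → - G b a))     ≡⟨ sumFin-cong n (λ b → neg-distrib-sumFin n (G b)) ⟨
  sumFin n (λ b → - sumFin n (G b))             ≡⟨ neg-distrib-sumFin n _ ⟨
  - sumFin n (λ a → sumFin n (G a))             ∎)
  where open ≡-Reasoning

punchIn-punchOut-swap : ∀ {m} {a b : Fin (suc (suc m))} (a≢b : a ≢ b) (b≢a : b ≢ a) x →
                        punchIn a (punchIn (punchOut a≢b) x) ≡ punchIn b (punchIn (punchOut b≢a) x)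
punchIn-punchOut-swap {a = zero}  {zero}  a≢b _ x = ⊥-elim (a≢b refl)
punchIn-punchOut-swap {a = zero}  {suc b} _   _ x = refl
punchIn-punchOut-swap {a = suc a} {zero}  _   _ x = refl
punchIn-punchOut-swap {suc m} {suc a} {suc b} _ _ zero = refl
punchIn-punchOut-swap {suc m} {suc a} {suc b} a≢b b≢a (suc x) =
  cong suc (punchIn-punchOut-swap (a≢b ∘ cong suc) (b≢a ∘ cong suc) x)

sign-punchOut-swap : ∀ {m} {a b : Fin (suc (suc m))} (a≢b : a ≢ b) (b≢a : b ≢ a) →
                     sign a * sign (punchOut a≢b) ≡ - (sign b * sign (punchOut b≢a))
sign-punchOut-swap {a = zero}  {zero}  a≢b _ = ⊥-elim (a≢b refl)
sign-punchOut-swap {a = zero}  {suc b} _   _ = swap₁ (sign b)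
  where
  swap₁ : ∀ s → + 1 * s ≡ - (- s * + 1)
  swap₁ = solve-∀
sign-punchOut-swap {a = suc a} {zero}  _   _ = swap₂ (sign a)
  where
  swap₂ : ∀ s → - s * + 1 ≡ - (+ 1 * s)
  swap₂ = solve-∀
sign-punchOut-swap {zero}  {suc zero} {suc zero} a≢b _ = ⊥-elim (a≢b refl)
sign-punchOut-swap {suc m} {suc a} {suc b} a≢b b≢a =
  trans (negate-both (sign a) _) (trans (sign-punchOut-swap (a≢b ∘ cong suc) (b≢a ∘ cong suc)) (negate-inner (sign b) _))
  where
  negate-both : ∀ x y → - x * - y ≡ x * y
  negate-both = solve-∀
  negate-inner : ∀ x y → - (x * y) ≡ - (- x * - y)
  negate-inner = solve-∀

-- Expanding along rows 0 and 1 pairs the term of the columns (a , b) with that of (b , a),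
-- which has the opposite sign when the two rows are equal.
det-alternating-01 : ∀ m → AlternatingAt (det (suc (suc m))) zero (suc zero)
det-alternating-01 m M row₀≡row₁ = trans double-expansion (sumFin-antisymmetric (suc (suc m)) G G-anti)
  where
  open ≡-Reasoning
  D₂ : Fin (suc (suc m)) → Fin (suc m) → ℤ
  D₂ j k = det m (minor (minor M j) k)

  T : Fin (suc (suc m)) → Fin (suc m) → ℤ
  T j k = sign j * (M zero j * (sign k * (M zero (punchIn j k) * D₂ j k)))

  pairTerm : ∀ a b → Dec (a ≡ b) → ℤ
  pairTerm a b (yes _)   = + 0
  pairTerm a b (no  a≢b) = T a (punchOut a≢b)

  G : Fin (suc (suc m)) → Fin (suc (suc m)) → ℤ
  G a b = pairTerm a b (a ≟ b)

  G-diag : ∀ a → G a a ≡ + 0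
  G-diag a with a ≟ a
  ... | yes _   = refl
  ... | no  a≢a = ⊥-elim (a≢a refl)

  G-punchIn : ∀ a k → G a (punchIn a k) ≡ T a k
  G-punchIn a k with a ≟ punchIn a k
  ... | yes a≡ = ⊥-elim (punchInᵢ≢i a k (sym a≡))
  ... | no  a≢ = cong (T a) (trans (punchOut-cong a refl) (punchOut-punchIn a))

  G-anti : ∀ a b → G a b ≡ - G b a
  G-anti a b with a ≟ b | b ≟ a
  ... | yes _   | yes _   = refl
  ... | yes a≡b | no  b≢a = ⊥-elim (b≢a (sym a≡b))
  ... | no  a≢b | yes b≡a = ⊥-elim (a≢b (sym b≡a))
  ... | no  a≢b | no  b≢a = begin
    T a p
      ≡⟨ regroup (sign a) (M zero a) (sign p) (M zero (punchIn a p)) (D₂ a p) ⟩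
    (sign a * sign p) * (M zero a * M zero (punchIn a p) * D₂ a p)
      ≡⟨ cong₂ (λ s x → s * (M zero a * M zero x * D₂ a p)) (sign-punchOut-swap a≢b b≢a) (punchIn-punchOut a≢b) ⟩
    - (sign b * sign q) * (M zero a * M zero b * D₂ a p)
      ≡⟨ cong (λ d → - (sign b * sign q) * (M zero a * M zero b * d)) same-minor ⟩
    - (sign b * sign q) * (M zero a * M zero b * D₂ b q)
      ≡⟨ regroup′ (sign b) (sign q) (M zero a) (M zero b) (D₂ b q) ⟩
    - (sign b * (M zero b * (sign q * (M zero a * D₂ b q))))
      ≡⟨ cong (λ x → - (sign b * (M zero b * (sign q * (M zero x * D₂ b q))))) (punchIn-punchOut b≢a) ⟨
    - T b q
      ∎
    where
    p = punchOut a≢b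
    q = punchOut b≢a
    same-minor : D₂ a p ≡ D₂ b q
    same-minor = det-cong m (λ i l → cong (M (suc (suc i))) (punchIn-punchOut-swap a≢b b≢a l))
    regroup : ∀ s x s′ y d → s * (x * (s′ * (y * d))) ≡ (s * s′) * (x * y * d)
    regroup = solve-∀
    regroup′ : ∀ s s′ x y d → - (s * s′) * (x * y * d) ≡ - (s * (y * (s′ * (x * d))))
    regroup′ = solve-∀

  row-sum : ∀ j → expansionTerm M j ≡ sumFin (suc (suc m)) (G j)
  row-sum j = begin
    sign j * (M zero j * sumFin (suc m) (λ k → sign k * (M (suc zero) (punchIn j k) * D₂ j k)))
      ≡⟨ cong (λ d → sign j * (M zero j * d))
              (sumFin-cong (suc m) (λ k → cong (λ x → sign k * (x * D₂ j k)) (sym (row₀≡row₁ (punchIn j k))))) ⟩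
    sign j * (M zero j * sumFin (suc m) U)
      ≡⟨ cong (sign j *_) (*-distribˡ-sumFin (suc m) (M zero j) U) ⟩
    sign j * sumFin (suc m) (λ k → M zero j * U k)
      ≡⟨ *-distribˡ-sumFin (suc m) (sign j) (λ k → M zero j * U k) ⟩
    sumFin (suc m) (T j)
      ≡⟨ sumFin-cong (suc m) (G-punchIn j) ⟨
    sumFin (suc m) (G j ∘ punchIn j)
      ≡⟨ +-identityˡ _ ⟨
    + 0 + sumFin (suc m) (G j ∘ punchIn j)
      ≡⟨ cong (_+ sumFin (suc m) (G j ∘ punchIn j)) (G-diag j) ⟨
    G j j + sumFin (suc m) (G j ∘ punchIn j)
      ≡⟨ sumFin-punchIn (suc m) j (G j) ⟨
    sumFin (suc (suc m)) (G j)
      ∎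
    where
    U : Fin (suc m) → ℤ
    U k = sign k * (M zero (punchIn j k) * D₂ j k)

  double-expansion : det (suc (suc m)) M ≡ sumFin (suc (suc m)) (λ a → sumFin (suc (suc m)) (G a))
  double-expansion = sumFin-cong (suc (suc m)) row-sum

swap01 : ∀ {m} → Matrix (suc (suc m)) → Matrix (suc (suc m))
swap01 M zero          = M (suc zero)
swap01 M (suc zero)    = M zero
swap01 M (suc (suc i)) = M (suc (suc i))

det-swap01 : ∀ m (M : Matrix (suc (suc m))) → det (suc (suc m)) M ≡ - det (suc (suc m)) (swap01 M)
det-swap01 m M =
  swap-rows {zero} {suc zero} zero≢suc (det-alternating-01 m) {swap01 M} {M} (λ _ → refl) (λ _ → refl) other
  where
  open MultilinearProperties (det-isMultilinear (suc (suc m)))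
  other : ∀ i → i ≢ zero → i ≢ suc zero → ∀ k → M i k ≡ swap01 M i k
  other zero          i≢0 _   k = ⊥-elim (i≢0 refl)
  other (suc zero)    _   i≢1 k = ⊥-elim (i≢1 refl)
  other (suc (suc i)) _   _   k = refl

mutual
  det-alternating : ∀ n → Alternating (det n)
  det-alternating (suc n) {zero}  {zero}  a≢b = ⊥-elim (a≢b refl)
  det-alternating (suc n) {zero}  {suc b} _   = det-alternating-zero n b
  det-alternating (suc n) {suc a} {zero}  _   = λ M rows → det-alternating-zero n a M (sym ∘ rows)
  det-alternating (suc n) {suc a} {suc b} a≢b = det-alternating-suc n (a≢b ∘ cong suc)

  det-alternating-zero : ∀ n (b : Fin n) → AlternatingAt (det (suc n)) zero (suc b)
  det-alternating-zero (suc m) zero    = det-alternating-01 m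
  det-alternating-zero (suc m) (suc b) M rows =
    trans (det-swap01 m M) (cong -_ (det-alternating-suc (suc m) {zero} {suc b} zero≢suc (swap01 M) rows))

  det-alternating-suc : ∀ n {a b : Fin n} → a ≢ b → AlternatingAt (det (suc n)) (suc a) (suc b)
  det-alternating-suc n a≢b M rows = sumFin-zero (suc n) λ j →
    trans (cong (λ d → sign j * (M zero j * d)) (det-alternating n a≢b (minor M j) (rows ∘ punchIn j)))
          (trans (cong (sign j *_) (*-zeroʳ (M zero j))) (*-zeroʳ (sign j)))

-- Uniqueness of alternating multilinear forms

coordinatewise-constant : ∀ n (g : (Fin n → ℤ) → ℤ) →
                          (∀ {x y} → (∀ i → x i ≡ y i) → g x ≡ g y) →
                          (∀ i {x y} → (∀ j → j ≢ i → x j ≡ y j) → g x ≡ g y) →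
                          ∀ x y → g x ≡ g y
coordinatewise-constant zero    g g-cong g-local x y = g-cong (λ ())
coordinatewise-constant (suc n) g g-cong g-local x y =
  trans (g-local zero {x} {y zero ∷ tail x} off-zero)
        (trans (coordinatewise-constant n g′ g′-cong g′-local (tail x) (tail y))
               (g-cong {y zero ∷ tail y} {y} (λ { zero → refl ; (suc i) → refl })))
  where
  g′ : (Fin n → ℤ) → ℤ
  g′ z = g (y zero ∷ z)
  g′-cong : ∀ {z z′} → (∀ i → z i ≡ z′ i) → g′ z ≡ g′ z′
  g′-cong z≗z′ = g-cong (λ { zero → refl ; (suc i) → z≗z′ i })
  g′-local : ∀ i {z z′} → (∀ j → j ≢ i → z j ≡ z′ j) → g′ z ≡ g′ z′
  g′-local i z≈z′ = g-local (suc i) (λ { zero _ → refl ; (suc j) j≢i → z≈z′ j (j≢i ∘ cong suc) })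
  off-zero : ∀ j → j ≢ zero → x j ≡ (y zero ∷ tail x) j
  off-zero zero    j≢0 = ⊥-elim (j≢0 refl)
  off-zero (suc j) _   = refl

insertZeroAt : ∀ {n} → Fin (suc n) → (Fin n → ℤ) → Fin (suc n) → ℤ
insertZeroAt j v k with j ≟ k
... | yes _   = + 0
... | no  j≢k = v (punchOut j≢k)

insertZeroAt-cong : ∀ {n} j {u v : Fin n → ℤ} → (∀ k → u k ≡ v k) →
                    ∀ k → insertZeroAt j u k ≡ insertZeroAt j v k
insertZeroAt-cong j u≗v k with j ≟ k
... | yes _ = refl
... | no  _ = u≗v _

insertZeroAt-linear : ∀ {n} j c {u v w : Fin n → ℤ} → (∀ k → u k ≡ c * v k + w k) →
                      ∀ k → insertZeroAt j u k ≡ c * insertZeroAt j v k + insertZeroAt j w k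
insertZeroAt-linear j c u≗cv+w k with j ≟ k
... | yes _ = sym (trans (+-identityʳ (c * + 0)) (*-zeroʳ c))
... | no  _ = u≗cv+w _

insertZeroAt-I : ∀ {n} j (i : Fin n) k → insertZeroAt j (I i) k ≡ I (punchIn j i) k
insertZeroAt-I j i k with j ≟ k
... | yes refl = sym (scalar-offDiag (+ 1) (punchInᵢ≢i j i))
... | no  j≢k  with i ≟ punchOut j≢k
...   | yes i≡ = sym (trans (cong (λ x → I x k) (trans (cong (punchIn j) i≡) (punchIn-punchOut j≢k)))
                            (scalar-diag (+ 1) k))
...   | no  i≢ = sym (scalar-offDiag (+ 1) (λ eq → i≢ (punchIn-injective j i _ (trans eq (sym (punchIn-punchOut j≢k))))))

insertZeroAt-clears : ∀ {n} (v : Fin (suc n) → ℤ) j k →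
                      v k + - v j * I j k ≡ insertZeroAt j (v ∘ punchIn j) k
insertZeroAt-clears v j k with j ≟ k
... | yes refl = cancel (v j)
  where
  cancel : ∀ x → x + - x * + 1 ≡ + 0
  cancel = solve-∀
... | no  j≢k  = trans (cong (_+_ (v k)) (*-zeroʳ (- v j)))
                       (trans (+-identityʳ (v k)) (cong v (sym (punchIn-punchOut j≢k))))

insertPivot : ∀ {n} → Fin (suc n) → Matrix n → Matrix (suc n)
insertPivot j N zero    = I j
insertPivot j N (suc i) = insertZeroAt j (N i)

rotation : ∀ {n} → Fin (suc n) → Matrix (suc n)
rotation j zero    = I j
rotation j (suc i) = I (punchIn j i)

punchIn-inject₁-self : ∀ {n} (j : Fin n) → punchIn (inject₁ j) j ≡ suc j
punchIn-inject₁-self zero    = refl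
punchIn-inject₁-self (suc j) = cong suc (punchIn-inject₁-self j)

punchIn-suc-self : ∀ {n} (j : Fin n) → punchIn (suc j) j ≡ inject₁ j
punchIn-suc-self zero    = refl
punchIn-suc-self (suc j) = cong suc (punchIn-suc-self j)

punchIn-suc≡punchIn-inject₁ : ∀ {n} {i j : Fin n} → i ≢ j → punchIn (suc j) i ≡ punchIn (inject₁ j) i
punchIn-suc≡punchIn-inject₁ {i = zero}  {zero}  i≢j = ⊥-elim (i≢j refl)
punchIn-suc≡punchIn-inject₁ {i = zero}  {suc j} _   = refl
punchIn-suc≡punchIn-inject₁ {i = suc i} {zero}  _   = refl
punchIn-suc≡punchIn-inject₁ {i = suc i} {suc j} i≢j = cong suc (punchIn-suc≡punchIn-inject₁ (i≢j ∘ cong suc))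

sign-inject₁ : ∀ {n} (j : Fin n) → sign (inject₁ j) ≡ sign j
sign-inject₁ zero    = refl
sign-inject₁ (suc j) = cong -_ (sign-inject₁ j)

module AlternatingMultilinear {n} {f : Matrix (suc n) → ℤ}
                              (f-multilinear : IsMultilinear f) (f-alternating : Alternating f) where
  open IsMultilinear f-multilinear
  open MultilinearProperties f-multilinear

  restrict : Fin (suc n) → Matrix n → ℤ
  restrict j N = f (insertPivot j N)

  restrict-multilinear : ∀ j → IsMultilinear (restrict j)
  restrict-multilinear j = record
    { respects-≗ᴹ = λ N≗N′ → respects-≗ᴹ λ { zero k → refl ; (suc i) → insertZeroAt-cong j (N≗N′ i) }
    ; linear      = λ r c N≈N₁ N≈N₂ row →
        linear (suc r) c (lift N≈N₁) (lift N≈N₂) (insertZeroAt-linear j c row)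
    }
    where
    lift : ∀ {r} {N N′ : Matrix n} → AgreeOffRow r N N′ →
           AgreeOffRow (suc r) (insertPivot j N) (insertPivot j N′)
    lift N≈N′ zero    _     k = refl
    lift N≈N′ (suc i) i≢1+r k = insertZeroAt-cong j (N≈N′ i (i≢1+r ∘ cong suc)) k

  restrict-alternating : ∀ j → Alternating (restrict j)
  restrict-alternating j a≢b N rows =
    f-alternating (a≢b ∘ suc-injective) (insertPivot j N) (insertZeroAt-cong j rows)

  -- In X x, the coordinate x i only adds a multiple of the pivot row e_j to row i + 1,
  -- which does not change f; so g is constant and column j can be cleared.
  clear-column : ∀ (M : Matrix (suc n)) j → f (setRow M zero (I j)) ≡ restrict j (minor M j)
  clear-column M j = begin
    f (setRow M zero (I j))
      ≡⟨ respects-≗ᴹ X₀ ⟩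
    g (λ _ → + 0)
      ≡⟨ coordinatewise-constant n g (λ x≗y → respects-≗ᴹ (X-cong x≗y)) g-local _ _ ⟩
    g (λ i → - M (suc i) j)
      ≡⟨ respects-≗ᴹ X-cleared ⟩
    f (insertPivot j (minor M j))
      ∎
    where
    open ≡-Reasoning
    X : (Fin n → ℤ) → Matrix (suc n)
    X x zero    k = I j k
    X x (suc i) k = M (suc i) k + x i * I j k
    g : (Fin n → ℤ) → ℤ
    g x = f (X x)
    X-cong : ∀ {x y} → (∀ i → x i ≡ y i) → X x ≗ᴹ X y
    X-cong x≗y zero    k = refl
    X-cong x≗y (suc i) k = cong (λ c → M (suc i) k + c * I j k) (x≗y i)
    g-local : ∀ i {x y} → (∀ l → l ≢ i → x l ≡ y l) → g x ≡ g y
    g-local i {x} {y} x≈y = add-multiple-of-row {suc i} {zero} (λ ()) (f-alternating (λ ())) (x i - y i) agree row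
      where
      agree : AgreeOffRow (suc i) (X x) (X y)
      agree zero    _     k = refl
      agree (suc l) l≢1+i k = cong (λ c → M (suc l) k + c * I j k) (x≈y l (l≢1+i ∘ cong suc))
      shift : ∀ m e x y → m + x * e ≡ (m + y * e) + (x - y) * e
      shift = solve-∀
      row : ∀ k → X x (suc i) k ≡ X y (suc i) k + (x i - y i) * X y zero k
      row k = shift (M (suc i) k) (I j k) (x i) (y i)
    X₀ : setRow M zero (I j) ≗ᴹ X (λ _ → + 0)
    X₀ zero    k = setRow-same M zero (I j) k
    X₀ (suc i) k = trans (setRow-other M {zero} (I j) k (λ ()))
                         (sym (trans (cong (_+_ (M (suc i) k)) (*-zeroˡ (I j k))) (+-identityʳ (M (suc i) k))))
    X-cleared : X (λ i → - M (suc i) j) ≗ᴹ insertPivot j (minor M j)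
    X-cleared zero    k = refl
    X-cleared (suc i) k = insertZeroAt-clears (M (suc i)) j k

  rotation-sign : ∀ j → f (rotation j) ≡ sign j * f I
  rotation-sign = <-weakInduction (λ j → f (rotation j) ≡ sign j * f I) base step
    where
    base : f (rotation zero) ≡ + 1 * f I
    base = trans (respects-≗ᴹ (λ { zero k → refl ; (suc i) k → refl })) (sym (*-identityˡ (f I)))
    step : ∀ j → f (rotation (inject₁ j)) ≡ sign (inject₁ j) * f I → f (rotation (suc j)) ≡ sign (suc j) * f I
    step j hyp = begin
      f (rotation (suc j))                ≡⟨ swap-rows zero≢suc (f-alternating zero≢suc) row₀ row₁₊ⱼ other ⟩
      - f (rotation (inject₁ j))          ≡⟨ cong -_ hyp ⟩
      - (sign (inject₁ j) * f I)          ≡⟨ neg-distribˡ (sign (inject₁ j)) (f I) ⟩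
      - sign (inject₁ j) * f I            ≡⟨ cong (λ s → - s * f I) (sign-inject₁ j) ⟩
      - sign j * f I                      ∎
      where
      open ≡-Reasoning
      neg-distribˡ : ∀ x y → - (x * y) ≡ - x * y
      neg-distribˡ = solve-∀
      row₀ : ∀ k → I (suc j) k ≡ I (punchIn (inject₁ j) j) k
      row₀ k = cong (λ x → I x k) (sym (punchIn-inject₁-self j))
      row₁₊ⱼ : ∀ k → I (punchIn (suc j) j) k ≡ I (inject₁ j) k
      row₁₊ⱼ k = cong (λ x → I x k) (punchIn-suc-self j)
      other : ∀ i → i ≢ zero → i ≢ suc j → ∀ k → rotation (suc j) i k ≡ rotation (inject₁ j) i k
      other zero    i≢0 _     k = ⊥-elim (i≢0 refl)
      other (suc i) _   i≢1+j k = cong (λ x → I x k) (punchIn-suc≡punchIn-inject₁ (i≢1+j ∘ cong suc))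

  restrict-I : ∀ j → restrict j I ≡ sign j * f I
  restrict-I j = trans (respects-≗ᴹ λ { zero k → refl ; (suc i) → insertZeroAt-I j i }) (rotation-sign j)

det-unique : ∀ n {f : Matrix n → ℤ} → IsMultilinear f → Alternating f → ∀ M → f M ≡ det n M * f I
det-unique zero    ml alt M = trans (IsMultilinear.respects-≗ᴹ ml (λ ())) (sym (*-identityˡ _))
det-unique (suc n) {f} ml alt M = begin
  f M
    ≡⟨ row-expansion (suc n) zero (M zero) I (λ k → sym (sumFin-I-selectʳ (suc n) k (M zero))) ⟩
  sumFin (suc n) (λ j → M zero j * f (setRow M zero (I j)))
    ≡⟨ sumFin-cong (suc n) (λ j → cong (M zero j *_) (clear-column M j)) ⟩
  sumFin (suc n) (λ j → M zero j * restrict j (minor M j))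
    ≡⟨ sumFin-cong (suc n) (λ j → cong (M zero j *_)
         (trans (det-unique n (restrict-multilinear j) (restrict-alternating j) (minor M j))
                (cong (det n (minor M j) *_) (restrict-I j)))) ⟩
  sumFin (suc n) (λ j → M zero j * (det n (minor M j) * (sign j * f I)))
    ≡⟨ sumFin-cong (suc n) (λ j → regroup (M zero j) (det n (minor M j)) (sign j) (f I)) ⟩
  sumFin (suc n) (λ j → f I * expansionTerm M j)
    ≡⟨ *-distribˡ-sumFin (suc n) (f I) (expansionTerm M) ⟨
  f I * det (suc n) M
    ≡⟨ *-comm (f I) _ ⟩
  det (suc n) M * f I
    ∎
  where
  open ≡-Reasoning
  open MultilinearProperties ml
  open AlternatingMultilinear ml alt
  regroup : ∀ x d s y → x * (d * (s * y)) ≡ y * (s * (x * d))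
  regroup = solve-∀

det-mul : ∀ n (M N : Matrix n) → det n (M *ᴹ N) ≡ det n M * det n N
det-mul n M N = trans (det-unique n multilinear alternating M)
                      (cong (det n M *_) (det-cong n (λ i k → sumFin-I-selectˡ n i (λ l → N l k))))
  where
  multilinear : IsMultilinear (λ M → det n (M *ᴹ N))
  multilinear = record
    { respects-≗ᴹ = λ M≗M′ → det-cong n (λ i k → sumFin-cong n (λ l → cong (_* N l k) (M≗M′ i l)))
    ; linear      = λ r c M≈M₁ M≈M₂ row →
        det-linear n r c (λ i i≢r k → sumFin-cong n (λ l → cong (_* N l k) (M≈M₁ i i≢r l)))
                         (λ i i≢r k → sumFin-cong n (λ l → cong (_* N l k) (M≈M₂ i i≢r l)))
                         (λ k → sumFin-linear n c (λ l → trans (cong (_* N l k) (row l)) (distrib c _ _ (N l k))))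
    }
    where
    distrib : ∀ c x y z → (c * x + y) * z ≡ c * (x * z) + y * z
    distrib = solve-∀
  alternating : Alternating (λ M → det n (M *ᴹ N))
  alternating a≢b M rows = det-alternating n a≢b (M *ᴹ N) (λ k → sumFin-cong n (λ l → cong (_* N l k) (rows l)))

expansionTerm-zero : ∀ {n} (M : Matrix (suc n)) j → M zero j ≡ + 0 → expansionTerm M j ≡ + 0
expansionTerm-zero {n} M j M₀ⱼ≡0 = trans (cong (λ x → sign j * (x * det n (minor M j))) M₀ⱼ≡0)
                                         (trans (cong (sign j *_) (*-zeroˡ (det n (minor M j)))) (*-zeroʳ (sign j)))

det-I : ∀ n → det n I ≡ + 1
det-I zero    = refl
det-I (suc n) = begin
  + 1 * (+ 1 * det n (minor I zero)) + sumFin n (λ j → expansionTerm I (suc j))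
    ≡⟨ cong₂ _+_ (trans (*-identityˡ _) (trans (*-identityˡ _) (trans (det-cong n (scalar-suc (+ 1))) (det-I n))))
                 (sumFin-zero n (λ j → expansionTerm-zero I (suc j) (scalar-offDiag (+ 1) (zero≢suc {r = j})))) ⟩
  + 1 + + 0
    ≡⟨⟩
  + 1 ∎
  where open ≡-Reasoning

punchIn-↑ˡ : ∀ {a} b (j : Fin (suc a)) (k : Fin a) → punchIn (j ↑ˡ b) (k ↑ˡ b) ≡ punchIn j k ↑ˡ b
punchIn-↑ˡ b zero    k       = refl
punchIn-↑ˡ b (suc j) zero    = refl
punchIn-↑ˡ b (suc j) (suc k) = cong suc (punchIn-↑ˡ b j k)

punchIn-↑ʳ : ∀ a {b} (j : Fin (suc a)) (k : Fin b) → punchIn (j ↑ˡ b) (a ↑ʳ k) ≡ suc a ↑ʳ k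
punchIn-↑ʳ a       zero    k = refl
punchIn-↑ʳ (suc a) (suc j) k = cong suc (punchIn-↑ʳ a j k)

sign-↑ˡ : ∀ {a} b (j : Fin a) → sign (j ↑ˡ b) ≡ sign j
sign-↑ˡ b zero    = refl
sign-↑ˡ b (suc j) = cong -_ (sign-↑ˡ b j)

det-lowerBlockTriangular : ∀ a b {X : Matrix a} {Z : Matrix b} {M : Matrix (a +ℕ b)} →
  (∀ i j → M (i ↑ˡ b) (j ↑ˡ b) ≡ X i j) → (∀ i j → M (i ↑ˡ b) (a ↑ʳ j) ≡ + 0) →
  (∀ i j → M (a ↑ʳ i) (a ↑ʳ j) ≡ Z i j) → det (a +ℕ b) M ≡ det a X * det b Z
det-lowerBlockTriangular zero    b {X} {Z} M-X M-0 M-Z = trans (det-cong b M-Z) (sym (*-identityˡ (det b Z)))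
det-lowerBlockTriangular (suc a) b {X} {Z} {M} M-X M-0 M-Z = begin
  det (suc a +ℕ b) M
    ≡⟨ sumFin-↑ (suc a) b (expansionTerm M) ⟩
  sumFin (suc a) (λ j → expansionTerm M (j ↑ˡ b)) + sumFin b (λ j → expansionTerm M (suc a ↑ʳ j))
    ≡⟨ cong₂ _+_ (sumFin-cong (suc a) left-columns) (sumFin-zero b right-columns) ⟩
  sumFin (suc a) (λ j → det b Z * expansionTerm X j) + + 0
    ≡⟨ +-identityʳ _ ⟩
  sumFin (suc a) (λ j → det b Z * expansionTerm X j)
    ≡⟨ *-distribˡ-sumFin (suc a) (det b Z) (expansionTerm X) ⟨
  det b Z * det (suc a) X
    ≡⟨ *-comm (det b Z) _ ⟩
  det (suc a) X * det b Z
    ∎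
  where
  open ≡-Reasoning
  regroup : ∀ s x d z → s * (x * (d * z)) ≡ z * (s * (x * d))
  regroup = solve-∀
  left-columns : ∀ j → expansionTerm M (j ↑ˡ b) ≡ det b Z * expansionTerm X j
  left-columns j = begin
    sign (j ↑ˡ b) * (M zero (j ↑ˡ b) * det (a +ℕ b) (minor M (j ↑ˡ b)))
      ≡⟨ cong₂ (λ s x → s * (x * det (a +ℕ b) (minor M (j ↑ˡ b)))) (sign-↑ˡ b j) (M-X zero j) ⟩
    sign j * (X zero j * det (a +ℕ b) (minor M (j ↑ˡ b)))
      ≡⟨ cong (λ d → sign j * (X zero j * d))
              (det-lowerBlockTriangular a b
                 (λ i k → trans (cong (M (suc i ↑ˡ b)) (punchIn-↑ˡ b j k)) (M-X (suc i) (punchIn j k)))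
                 (λ i k → trans (cong (M (suc i ↑ˡ b)) (punchIn-↑ʳ a j k)) (M-0 (suc i) k))
                 (λ i k → trans (cong (M (suc a ↑ʳ i)) (punchIn-↑ʳ a j k)) (M-Z i k))) ⟩
    sign j * (X zero j * (det a (minor X j) * det b Z))
      ≡⟨ regroup (sign j) (X zero j) (det a (minor X j)) (det b Z) ⟩
    det b Z * expansionTerm X j
      ∎
  right-columns : ∀ j → expansionTerm M (suc a ↑ʳ j) ≡ + 0
  right-columns j = expansionTerm-zero M (suc a ↑ʳ j) (M-0 zero j)

det-neg : ∀ n (M : Matrix n) → det n (λ i j → - M i j) ≡ -1ℤ ^ n * det n M
det-neg zero    M = refl
det-neg (suc n) M = begin
  sumFin (suc n) (λ j → sign j * (- M zero j * det n (λ i k → - M (suc i) (punchIn j k))))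
    ≡⟨ sumFin-cong (suc n) (λ j → trans (cong (λ d → sign j * (- M zero j * d)) (det-neg n (minor M j)))
                                        (regroup (sign j) (M zero j) (-1ℤ ^ n) (det n (minor M j)))) ⟩
  sumFin (suc n) (λ j → (-1ℤ * -1ℤ ^ n) * expansionTerm M j)
    ≡⟨ *-distribˡ-sumFin (suc n) (-1ℤ * -1ℤ ^ n) (expansionTerm M) ⟨
  (-1ℤ * -1ℤ ^ n) * det (suc n) M
    ∎
  where
  open ≡-Reasoning
  regroup : ∀ s x p d → s * (- x * (p * d)) ≡ (-1ℤ * p) * (s * (x * d))
  regroup = solve-∀

-- The characteristic polynomial of the duplicate graph

χ : ∀ {n} → Matrix n → ℤ → ℤ
χ {n} M t = det n (λ i j → scalar t i j - M i j)

-- The underscore stands for the entries of the matrix in charPoly, whose diagonal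
-- helper is local to Defs and cannot be named here.
mutual
  charPoly≡χ : ∀ {n} (G : Graph n) t → charPoly G t ≡ χ (A G) t
  charPoly≡χ {n} G t = det-cong n (charPoly-entries G t)

  charPoly-entries : ∀ {n} (G : Graph n) t (i j : Fin n) → _ ≡ scalar t i j - A G i j
  charPoly-entries G t i j with i ≟ j
  ... | yes _ = refl
  ... | no  _ = refl

χ-neg : ∀ n (M : Matrix n) t → χ (λ i j → - M i j) t ≡ -1ℤ ^ n * χ M (- t)
χ-neg n M t = trans (det-cong n entries) (det-neg n (λ i j → scalar (- t) i j - M i j))
  where
  negate : ∀ x y → x - - y ≡ - (- x - y)
  negate = solve-∀
  entries : ∀ i j → scalar t i j - - M i j ≡ - (scalar (- t) i j - M i j)
  entries i j = trans (negate (scalar t i j) (M i j)) (cong (λ x → - (x - M i j)) (sym (scalar-neg t i j)))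

Block : ℕ → Set
Block n = Fin n ⊎ Fin n → Fin n ⊎ Fin n → ℤ

toMatrix : ∀ {n} → Block n → Matrix (n +ℕ n)
toMatrix {n} B i j = B (splitAt n i) (splitAt n j)

infixl 7 _*ᴮ_
_*ᴮ_ : ∀ {n} → Block n → Block n → Block n
_*ᴮ_ {n} P Q u w = sumFin n (λ l → P u (inj₁ l) * Q (inj₁ l) w) + sumFin n (λ l → P u (inj₂ l) * Q (inj₂ l) w)

toMatrix-*ᴮ : ∀ {n} (P Q : Block n) → toMatrix P *ᴹ toMatrix Q ≗ᴹ toMatrix (P *ᴮ Q)
toMatrix-*ᴮ {n} P Q i k = trans (sumFin-↑ n n (λ l → toMatrix P i l * toMatrix Q l k))
  (cong₂ _+_ (sumFin-cong n (λ l → cong (λ u → P (splitAt n i) u * Q u (splitAt n k)) (splitAt-↑ˡ n l n)))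
             (sumFin-cong n (λ l → cong (λ u → P (splitAt n i) u * Q u (splitAt n k)) (splitAt-↑ʳ n n l))))

blockScalar : ∀ {n} → ℤ → Block n
blockScalar t (inj₁ a) (inj₁ b) = scalar t a b
blockScalar t (inj₁ a) (inj₂ b) = + 0
blockScalar t (inj₂ a) (inj₁ b) = + 0
blockScalar t (inj₂ a) (inj₂ b) = scalar t a b

blockScalar-offDiag : ∀ {n} t {u w : Fin n ⊎ Fin n} → u ≢ w → blockScalar t u w ≡ + 0
blockScalar-offDiag t {inj₁ a} {inj₁ b} u≢w = scalar-offDiag t (u≢w ∘ cong inj₁)
blockScalar-offDiag t {inj₁ a} {inj₂ b} u≢w = refl
blockScalar-offDiag t {inj₂ a} {inj₁ b} u≢w = refl
blockScalar-offDiag t {inj₂ a} {inj₂ b} u≢w = scalar-offDiag t (u≢w ∘ cong inj₂)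

scalar≡toMatrix-blockScalar : ∀ {n} t → scalar t ≗ᴹ toMatrix (blockScalar {n} t)
scalar≡toMatrix-blockScalar {n} t i j with i ≟ j
... | yes refl = sym (diag (splitAt n i))
  where
  diag : ∀ u → blockScalar t u u ≡ t
  diag (inj₁ a) = scalar-diag t a
  diag (inj₂ a) = scalar-diag t a
... | no  i≢j  = sym (blockScalar-offDiag t (λ eq → i≢j (splitAt-injective eq)))
  where
  splitAt-injective : splitAt n i ≡ splitAt n j → i ≡ j
  splitAt-injective eq = trans (sym (join-splitAt n n i)) (trans (cong (join n n) eq) (join-splitAt n n j))

shear shear⁻¹ : ∀ {n} → Block n
shear (inj₁ a) (inj₁ b) = I a b
shear (inj₁ a) (inj₂ b) = I a b
shear (inj₂ a) (inj₁ b) = + 0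
shear (inj₂ a) (inj₂ b) = I a b
shear⁻¹ (inj₁ a) (inj₁ b) = I a b
shear⁻¹ (inj₁ a) (inj₂ b) = - I a b
shear⁻¹ (inj₂ a) (inj₁ b) = + 0
shear⁻¹ (inj₂ a) (inj₂ b) = I a b

shear-*ᴮ-upper : ∀ {n} (X : Block n) a w → (shear *ᴮ X) (inj₁ a) w ≡ X (inj₁ a) w + X (inj₂ a) w
shear-*ᴮ-upper {n} X a w =
  cong₂ _+_ (sumFin-I-selectˡ n a (λ l → X (inj₁ l) w)) (sumFin-I-selectˡ n a (λ l → X (inj₂ l) w))

shear-*ᴮ-lower : ∀ {n} (X : Block n) a w → (shear *ᴮ X) (inj₂ a) w ≡ X (inj₂ a) w
shear-*ᴮ-lower {n} X a w = trans (cong₂ _+_ (sumFin-zero n (λ l → *-zeroˡ (X (inj₁ l) w)))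
                                            (sumFin-I-selectˡ n a (λ l → X (inj₂ l) w)))
                                 (+-identityˡ _)

*ᴮ-shear⁻¹-left : ∀ {n} (X : Block n) u b → (X *ᴮ shear⁻¹) u (inj₁ b) ≡ X u (inj₁ b)
*ᴮ-shear⁻¹-left {n} X u b = trans (cong₂ _+_ (sumFin-I-selectʳ n b (λ l → X u (inj₁ l)))
                                             (sumFin-zero n (λ l → *-zeroʳ (X u (inj₂ l)))))
                                  (+-identityʳ _)

*ᴮ-shear⁻¹-right : ∀ {n} (X : Block n) u b → (X *ᴮ shear⁻¹) u (inj₂ b) ≡ - X u (inj₁ b) + X u (inj₂ b)
*ᴮ-shear⁻¹-right {n} X u b = cong₂ _+_ negated (sumFin-I-selectʳ n b (λ l → X u (inj₂ l)))
  where
  negated : sumFin n (λ l → X u (inj₁ l) * - I l b) ≡ - X u (inj₁ b)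
  negated = begin
    sumFin n (λ l → X u (inj₁ l) * - I l b)     ≡⟨ sumFin-cong n (λ l → *-neg (X u (inj₁ l)) (I l b)) ⟩
    sumFin n (λ l → - (X u (inj₁ l) * I l b))   ≡⟨ neg-distrib-sumFin n _ ⟨
    - sumFin n (λ l → X u (inj₁ l) * I l b)     ≡⟨ cong -_ (sumFin-I-selectʳ n b (λ l → X u (inj₁ l))) ⟩
    - X u (inj₁ b)                              ∎
    where
    open ≡-Reasoning
    *-neg : ∀ x y → x * - y ≡ - (x * y)
    *-neg = solve-∀

shear-*ᴮ-shear⁻¹ : ∀ {n} u w → (shear {n} *ᴮ shear⁻¹) u w ≡ blockScalar (+ 1) u w
shear-*ᴮ-shear⁻¹ (inj₁ a) (inj₁ b) = *ᴮ-shear⁻¹-left shear (inj₁ a) b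
shear-*ᴮ-shear⁻¹ (inj₁ a) (inj₂ b) = trans (*ᴮ-shear⁻¹-right shear (inj₁ a) b) (+-inverseˡ (I a b))
shear-*ᴮ-shear⁻¹ (inj₂ a) (inj₁ b) = *ᴮ-shear⁻¹-left shear (inj₂ a) b
shear-*ᴮ-shear⁻¹ (inj₂ a) (inj₂ b) = trans (*ᴮ-shear⁻¹-right shear (inj₂ a) b) (+-identityˡ (I a b))

det-shear : ∀ n → det (n +ℕ n) (toMatrix {n} shear) * det (n +ℕ n) (toMatrix {n} shear⁻¹) ≡ + 1
det-shear n = begin
  det (n +ℕ n) (toMatrix {n} shear) * det (n +ℕ n) (toMatrix {n} shear⁻¹)   ≡⟨ det-mul (n +ℕ n) _ _ ⟨
  det (n +ℕ n) (toMatrix {n} shear *ᴹ toMatrix {n} shear⁻¹)                 ≡⟨ det-cong (n +ℕ n) product ⟩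
  det (n +ℕ n) I                                                    ≡⟨ det-I (n +ℕ n) ⟩
  + 1                                                               ∎
  where
  open ≡-Reasoning
  product : toMatrix {n} shear *ᴹ toMatrix {n} shear⁻¹ ≗ᴹ I
  product i k = trans (toMatrix-*ᴮ {n} shear shear⁻¹ i k)
                      (trans (shear-*ᴮ-shear⁻¹ (splitAt n i) (splitAt n k))
                             (sym (scalar≡toMatrix-blockScalar {n} (+ 1) i k)))

adjacencyBlock : ∀ {n} → Graph n → Block n
adjacencyBlock G u w = if dupAdj G u w then + 1 else + 0

charBlock : ∀ {n} → Graph n → ℤ → Block n
charBlock G t u w = blockScalar t u w - adjacencyBlock G u w

triangularBlock : ∀ {n} → Graph n → ℤ → Block n
triangularBlock G t (inj₁ a) (inj₁ b) = scalar t a b - A G a b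
triangularBlock G t (inj₁ a) (inj₂ b) = + 0
triangularBlock G t (inj₂ a) (inj₁ b) = - A G a b
triangularBlock G t (inj₂ a) (inj₂ b) = scalar t a b - - A G a b

shear-charBlock-shear⁻¹ : ∀ {n} (G : Graph n) t u w →
                          (shear *ᴮ charBlock G t *ᴮ shear⁻¹) u w ≡ triangularBlock G t u w
shear-charBlock-shear⁻¹ G t (inj₁ a) (inj₁ b) =
  trans (*ᴮ-shear⁻¹-left (shear *ᴮ charBlock G t) (inj₁ a) b)
        (trans (shear-*ᴮ-upper (charBlock G t) a (inj₁ b)) (ring (scalar t a b) (A G a b)))
  where
  ring : ∀ s x → (s - + 0) + (+ 0 - x) ≡ s - x
  ring = solve-∀
shear-charBlock-shear⁻¹ G t (inj₁ a) (inj₂ b) =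
  trans (*ᴮ-shear⁻¹-right (shear *ᴮ charBlock G t) (inj₁ a) b)
        (trans (cong₂ (λ x y → - x + y) (shear-*ᴮ-upper (charBlock G t) a (inj₁ b))
                                        (shear-*ᴮ-upper (charBlock G t) a (inj₂ b)))
               (ring (scalar t a b) (A G a b)))
  where
  ring : ∀ s x → - ((s - + 0) + (+ 0 - x)) + ((+ 0 - x) + (s - + 0)) ≡ + 0
  ring = solve-∀
shear-charBlock-shear⁻¹ G t (inj₂ a) (inj₁ b) =
  trans (*ᴮ-shear⁻¹-left (shear *ᴮ charBlock G t) (inj₂ a) b)
        (trans (shear-*ᴮ-lower (charBlock G t) a (inj₁ b)) (+-identityˡ (- A G a b)))
shear-charBlock-shear⁻¹ G t (inj₂ a) (inj₂ b) =
  trans (*ᴮ-shear⁻¹-right (shear *ᴮ charBlock G t) (inj₂ a) b)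
        (trans (cong₂ (λ x y → - x + y) (shear-*ᴮ-lower (charBlock G t) a (inj₁ b))
                                        (shear-*ᴮ-lower (charBlock G t) a (inj₂ b)))
               (ring (scalar t a b) (A G a b)))
  where
  ring : ∀ s x → - (+ 0 - x) + (s - + 0) ≡ s - - x
  ring = solve-∀

charPoly-D : ∀ {n} (G : Graph n) t → charPoly (D G) t ≡ χ (A G) t * χ (λ a b → - A G a b) t
charPoly-D {n} G t = begin
  charPoly (D G) t
    ≡⟨ charPoly≡χ (D G) t ⟩
  det (n +ℕ n) (λ i j → scalar t i j - A (D G) i j)
    ≡⟨ det-cong (n +ℕ n) (λ i j → cong (_- A (D G) i j) (scalar≡toMatrix-blockScalar {n} t i j)) ⟩
  det (n +ℕ n) C
    ≡⟨ *-identityʳ _ ⟨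
  det (n +ℕ n) C * + 1
    ≡⟨ cong (det (n +ℕ n) C *_) (det-shear n) ⟨
  det (n +ℕ n) C * (det (n +ℕ n) S * det (n +ℕ n) S⁻¹)
    ≡⟨ regroup (det (n +ℕ n) C) (det (n +ℕ n) S) (det (n +ℕ n) S⁻¹) ⟩
  det (n +ℕ n) S * det (n +ℕ n) C * det (n +ℕ n) S⁻¹
    ≡⟨ cong (_* det (n +ℕ n) S⁻¹) (det-mul (n +ℕ n) S C) ⟨
  det (n +ℕ n) (S *ᴹ C) * det (n +ℕ n) S⁻¹
    ≡⟨ det-mul (n +ℕ n) (S *ᴹ C) S⁻¹ ⟨
  det (n +ℕ n) (S *ᴹ C *ᴹ S⁻¹)
    ≡⟨ det-cong (n +ℕ n) conjugate ⟩
  det (n +ℕ n) (toMatrix (triangularBlock G t))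
    ≡⟨ det-lowerBlockTriangular n n (λ i j → cong₂ (triangularBlock G t) (splitAt-↑ˡ n i n) (splitAt-↑ˡ n j n))
                                    (λ i j → cong₂ (triangularBlock G t) (splitAt-↑ˡ n i n) (splitAt-↑ʳ n n j))
                                    (λ i j → cong₂ (triangularBlock G t) (splitAt-↑ʳ n n i) (splitAt-↑ʳ n n j)) ⟩
  χ (A G) t * χ (λ a b → - A G a b) t
    ∎
  where
  open ≡-Reasoning
  C S S⁻¹ : Matrix (n +ℕ n)
  C = toMatrix (charBlock G t)
  S = toMatrix {n} shear
  S⁻¹ = toMatrix {n} shear⁻¹
  regroup : ∀ c s s′ → c * (s * s′) ≡ s * c * s′
  regroup = solve-∀
  conjugate : S *ᴹ C *ᴹ S⁻¹ ≗ᴹ toMatrix (triangularBlock G t)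
  conjugate i k = begin
    (S *ᴹ C *ᴹ S⁻¹) i k
      ≡⟨ sumFin-cong (n +ℕ n) (λ l → cong (_* S⁻¹ l k) (toMatrix-*ᴮ {n} shear (charBlock G t) i l)) ⟩
    (toMatrix (shear *ᴮ charBlock G t) *ᴹ S⁻¹) i k
      ≡⟨ toMatrix-*ᴮ {n} (shear *ᴮ charBlock G t) shear⁻¹ i k ⟩
    toMatrix (shear *ᴮ charBlock G t *ᴮ shear⁻¹) i k
      ≡⟨ shear-charBlock-shear⁻¹ G t (splitAt n i) (splitAt n k) ⟩
    toMatrix (triangularBlock G t) i k
      ∎

-- Integer polynomial functions

-- Poly d ℓ f: f is a polynomial function with d + 1 coefficients in Horner form, the leading one
-- being ℓ (possibly 0). So Poly d ℓ f bounds the degree by d, and Poly d (+ 1) f means monic of degree d.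
data Poly : ℕ → ℤ → (ℤ → ℤ) → Set where
  const  : ∀ {f} c → (∀ t → f t ≡ c) → Poly 0 c f
  horner : ∀ {d ℓ f} g c → Poly d ℓ g → (∀ t → f t ≡ t * g t + c) → Poly (suc d) ℓ f

poly-cong : ∀ {d ℓ f g} → (∀ t → f t ≡ g t) → Poly d ℓ f → Poly d ℓ g
poly-cong f≗g (const c f≡c)          = const c (λ t → trans (sym (f≗g t)) (f≡c t))
poly-cong f≗g (horner h c h-poly eq) = horner h c h-poly (λ t → trans (sym (f≗g t)) (eq t))

monic-degree-zero : ∀ {f} → Poly 0 (+ 1) f → ∀ t → f t ≡ + 1
monic-degree-zero (const _ f≡1) = f≡1

monic-degree-zero-no-root : ∀ {f m} → Poly 0 (+ 1) f → f m ≢ + 0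
monic-degree-zero-no-root {m = m} f-monic f-root with trans (sym (monic-degree-zero f-monic m)) f-root
... | ()

poly-scale : ∀ {d ℓ f} k → Poly d ℓ f → Poly d (k * ℓ) (λ t → k * f t)
poly-scale k (const c f≡c)          = const (k * c) (λ t → cong (k *_) (f≡c t))
poly-scale k (horner g c g-poly eq) =
  horner (λ t → k * g t) (k * c) (poly-scale k g-poly) (λ t → trans (cong (k *_) (eq t)) (distrib k t (g t) c))
  where
  distrib : ∀ k t g c → k * (t * g + c) ≡ t * (k * g) + k * c
  distrib = solve-∀

poly-+ : ∀ {d ℓ ℓ′ f g} → Poly d ℓ f → Poly d ℓ′ g → Poly d (ℓ + ℓ′) (λ t → f t + g t)
poly-+ (const c f≡c) (const c′ g≡c′) = const (c + c′) (λ t → cong₂ _+_ (f≡c t) (g≡c′ t))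
poly-+ (horner f′ c f′-poly f≡) (horner g′ c′ g′-poly g≡) =
  horner (λ t → f′ t + g′ t) (c + c′) (poly-+ f′-poly g′-poly)
         (λ t → trans (cong₂ _+_ (f≡ t) (g≡ t)) (collect t (f′ t) c (g′ t) c′))
  where
  collect : ∀ t f c g c′ → (t * f + c) + (t * g + c′) ≡ t * (f + g) + (c + c′)
  collect = solve-∀

mutual
  poly-+-lower : ∀ {d e ℓ ℓ′ f g} → Poly (suc d) ℓ f → Poly e ℓ′ g → e ≤ d →
                 Poly (suc d) ℓ (λ t → f t + g t)
  poly-+-lower (horner f′ c f′-poly f≡) (const c′ g≡c′) _ =
    horner f′ (c + c′) f′-poly (λ t → trans (cong₂ _+_ (f≡ t) (g≡c′ t)) (+-assoc (t * f′ t) c c′))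
  poly-+-lower (horner f′ c f′-poly f≡) (horner g′ c′ g′-poly g≡) (s≤s e≤d) =
    horner (λ t → f′ t + g′ t) (c + c′) (poly-+-lower f′-poly g′-poly e≤d)
           (λ t → trans (cong₂ _+_ (f≡ t) (g≡ t)) (collect t (f′ t) c (g′ t) c′))
    where
    collect : ∀ t f c g c′ → (t * f + c) + (t * g + c′) ≡ t * (f + g) + (c + c′)
    collect = solve-∀

  poly-shift : ∀ {d e ℓ ℓ′ f g} → Poly d ℓ f → Poly e ℓ′ g → e ≤ d →
               Poly (suc d) ℓ (λ t → t * f t + g t)
  poly-shift {f = f} f-poly (const c g≡c) _ = horner f c f-poly (λ t → cong (_+_ (t * f t)) (g≡c t))
  poly-shift {f = f} f-poly (horner g′ c g′-poly g≡) (s≤s e≤d) =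
    horner (λ t → f t + g′ t) c (poly-+-lower f-poly g′-poly e≤d)
           (λ t → trans (cong (_+_ (t * f t)) (g≡ t)) (collect t (f t) (g′ t) c))
    where
    collect : ∀ t f g c → t * f + (t * g + c) ≡ t * (f + g) + c
    collect = solve-∀

poly-* : ∀ {d e ℓ ℓ′ f g} → Poly d ℓ f → Poly e ℓ′ g → Poly (d +ℕ e) (ℓ * ℓ′) (λ t → f t * g t)
poly-* {g = g} (const c f≡c) g-poly = poly-cong (λ t → cong (_* g t) (sym (f≡c t))) (poly-scale c g-poly)
poly-* {suc d} {e} {g = g} (horner f′ c f′-poly f≡) g-poly =
  poly-cong (λ t → trans (sym (expand t (f′ t) c (g t))) (cong (_* g t) (sym (f≡ t))))
            (poly-shift (poly-* f′-poly g-poly) (poly-scale c g-poly) (ℕ.m≤n+m e d))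
  where
  expand : ∀ t f c g → (t * f + c) * g ≡ t * (f * g) + c * g
  expand = solve-∀

poly-zero : ∀ d → Poly d (+ 0) (λ _ → + 0)
poly-zero zero    = const (+ 0) (λ _ → refl)
poly-zero (suc d) = horner (λ _ → + 0) (+ 0) (poly-zero d) (λ t → sym (trans (+-identityʳ _) (*-zeroʳ t)))

poly-sumFin : ∀ n {d} (F : Fin n → ℤ → ℤ) → (∀ i → ∃ λ ℓ → Poly d ℓ (F i)) →
              ∃ λ ℓ → Poly d ℓ (λ t → sumFin n (λ i → F i t))
poly-sumFin zero    {d} F F-poly = + 0 , poly-zero d
poly-sumFin (suc n) F F-poly with F-poly zero | poly-sumFin n (F ∘ suc) (F-poly ∘ suc)
... | ℓ , head-poly | ℓ′ , tail-poly = ℓ + ℓ′ , poly-+ head-poly tail-poly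

poly-prodFin : ∀ n (μ : Fin n → ℤ) → Poly n (+ 1) (λ t → prodFin n (λ j → t - μ j))
poly-prodFin zero    μ = const (+ 1) (λ _ → refl)
poly-prodFin (suc n) μ =
  poly-cong (λ t → sym (expand t (μ zero) (prodFin n (λ j → t - μ (suc j)))))
            (poly-shift (poly-prodFin n (μ ∘ suc)) (poly-scale (- μ zero) (poly-prodFin n (μ ∘ suc))) ℕ.≤-refl)
  where
  expand : ∀ t m p → (t - m) * p ≡ t * p + - m * p
  expand = solve-∀

poly-factor : ∀ {d ℓ f} → Poly (suc d) ℓ f → ∀ b →
              Σ (ℤ → ℤ) λ h → Poly d ℓ h × (∀ t → f t ≡ (t - b) * h t + f b)
poly-factor {zero} {f = f} (horner g c (const ℓ g≡ℓ) f≡) b =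
  (λ _ → ℓ) , const ℓ (λ _ → refl) , λ t → begin
    f t                               ≡⟨ trans (f≡ t) (cong (λ x → t * x + c) (g≡ℓ t)) ⟩
    t * ℓ + c                         ≡⟨ divide t b ℓ c ⟩
    (t - b) * ℓ + (b * ℓ + c)         ≡⟨ cong (_+_ ((t - b) * ℓ)) (trans (f≡ b) (cong (λ x → b * x + c) (g≡ℓ b))) ⟨
    (t - b) * ℓ + f b                 ∎
  where
  open ≡-Reasoning
  divide : ∀ t b ℓ c → t * ℓ + c ≡ (t - b) * ℓ + (b * ℓ + c)
  divide = solve-∀
poly-factor {suc d} {f = f} (horner g c g-poly f≡) b with poly-factor g-poly b
... | h , h-poly , g≡ =
  (λ t → t * h t + g b) , horner h (g b) h-poly (λ _ → refl) , λ t → begin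
    f t                                          ≡⟨ trans (f≡ t) (cong (λ x → t * x + c) (g≡ t)) ⟩
    t * ((t - b) * h t + g b) + c                ≡⟨ divide t b (h t) (g b) c ⟩
    (t - b) * (t * h t + g b) + (b * g b + c)    ≡⟨ cong (_+_ ((t - b) * (t * h t + g b))) (f≡ b) ⟨
    (t - b) * (t * h t + g b) + f b              ∎
  where
  open ≡-Reasoning
  divide : ∀ t b h g c → t * ((t - b) * h + g) + c ≡ (t - b) * (t * h + g) + (b * g + c)
  divide = solve-∀

poly-divide : ∀ {d ℓ f} → Poly (suc d) ℓ f → ∀ {m} → f m ≡ + 0 →
              Σ (ℤ → ℤ) λ f′ → Poly d ℓ f′ × (∀ t → f t ≡ (t - m) * f′ t)
poly-divide f-poly {m} f-root with poly-factor f-poly m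
... | f′ , f′-poly , f≡ =
  f′ , f′-poly , λ t → trans (f≡ t) (trans (cong (_+_ ((t - m) * f′ t)) f-root) (+-identityʳ _))

t-b≢0 : ∀ t b → ∣ b ∣ < ∣ t ∣ → t - b ≢ + 0
t-b≢0 t b ∣b∣<∣t∣ t-b≡0 = ℕ.<-irrefl (cong ∣_∣ (sym (i-j≡0⇒i≡j t b t-b≡0))) ∣b∣<∣t∣

poly-vanish : ∀ {d ℓ f} → Poly d ℓ f → ∀ B → (∀ t → B < ∣ t ∣ → f t ≡ + 0) → ∀ t → f t ≡ + 0
poly-vanish {zero} (const c f≡c) B large t = trans (f≡c t) (trans (sym (f≡c +[1+ B ])) (large +[1+ B ] ℕ.≤-refl))
poly-vanish {suc d} {f = f} f-poly B large t with poly-factor f-poly +[1+ B ]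
... | h , h-poly , f≡ = begin
  f t                                ≡⟨ f≡ t ⟩
  (t - b) * h t + f b                ≡⟨ cong₂ (λ x y → (t - b) * x + y) (h≡0 t) f-b≡0 ⟩
  (t - b) * + 0 + + 0                ≡⟨ trans (+-identityʳ _) (*-zeroʳ (t - b)) ⟩
  + 0                                ∎
  where
  open ≡-Reasoning
  b = +[1+ B ]
  f-b≡0 : f b ≡ + 0
  f-b≡0 = large b ℕ.≤-refl
  h-large : ∀ t → suc B < ∣ t ∣ → h t ≡ + 0
  h-large t 1+B<∣t∣ with i*j≡0⇒i≡0∨j≡0 (t - b) (trans (sym (+-identityʳ _))
                                                (trans (cong (_+_ ((t - b) * h t)) (sym f-b≡0))
                                                       (trans (sym (f≡ t)) (large t (ℕ.<-trans ℕ.≤-refl 1+B<∣t∣)))))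
  ... | inj₁ t-b≡0 = ⊥-elim (t-b≢0 t b 1+B<∣t∣ t-b≡0)
  ... | inj₂ h-t≡0 = h-t≡0
  h≡0 : ∀ t → h t ≡ + 0
  h≡0 = poly-vanish h-poly (suc B) h-large

poly-cancel : ∀ {d ℓ ℓ′ f g} → Poly d ℓ f → Poly d ℓ′ g → ∀ m →
              (∀ t → (t - m) * f t ≡ (t - m) * g t) → ∀ t → f t ≡ g t
poly-cancel {f = f} {g} f-poly g-poly m eq t =
  i-j≡0⇒i≡j (f t) (g t) (trans (cong (_+_ (f t)) (sym (-1*x≡-x (g t))))
                               (poly-vanish (poly-+ f-poly (poly-scale -1ℤ g-poly)) ∣ m ∣ off-m t))
  where
  -1*x≡-x : ∀ x → -1ℤ * x ≡ - x
  -1*x≡-x = solve-∀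
  distrib : ∀ x y z → x * (y + -1ℤ * z) ≡ x * y - x * z
  distrib = solve-∀
  off-m : ∀ t → ∣ m ∣ < ∣ t ∣ → f t + -1ℤ * g t ≡ + 0
  off-m t ∣m∣<∣t∣ with i*j≡0⇒i≡0∨j≡0 (t - m) (trans (distrib (t - m) (f t) (g t))
                                                 (trans (cong (_- (t - m) * g t) (eq t)) (+-inverseʳ ((t - m) * g t))))
  ... | inj₁ t-m≡0 = ⊥-elim (t-b≢0 t m ∣m∣<∣t∣ t-m≡0)
  ... | inj₂ ≡0    = ≡0

poly-entry : ∀ {n} (i k : Fin n) c → ∃ λ ℓ → Poly 1 ℓ (λ t → scalar t i k - c)
poly-entry i k c with i ≟ k
... | yes _ = + 1 , horner (λ _ → + 1) (- c) (const (+ 1) (λ _ → refl)) (λ t → cong (_+ - c) (sym (*-identityʳ t)))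
... | no  _ = + 0 , horner (λ _ → + 0) (- c) (const (+ 0) (λ _ → refl)) (λ t → cong (_+ - c) (sym (*-zeroʳ t)))

poly-det : ∀ m (F : ℤ → Matrix m) → (∀ i k → ∃ λ ℓ → Poly 1 ℓ (λ t → F t i k)) →
           ∃ λ ℓ → Poly m ℓ (λ t → det m (F t))
poly-det zero    F F-poly = + 1 , const (+ 1) (λ _ → refl)
poly-det (suc m) F F-poly = poly-sumFin (suc m) _ term
  where
  term : ∀ j → ∃ λ ℓ → Poly (suc m) ℓ (λ t → sign j * (F t zero j * det m (minor (F t) j)))
  term j with F-poly zero j | poly-det m (λ t → minor (F t) j) (λ i k → F-poly (suc i) (punchIn j k))
  ... | _ , entry-poly | _ , minor-poly = _ , poly-scale (sign j) (poly-* entry-poly minor-poly)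

χ-monic : ∀ n (M : Matrix n) → Poly n (+ 1) (χ M)
χ-monic zero    M = const (+ 1) (λ _ → refl)
χ-monic (suc m) M =
  poly-cong expansion
    (poly-shift minor-monic (poly-+ (proj₂ rest-poly) (poly-scale (- M zero zero) minor-monic)) ℕ.≤-refl)
  where
  tI-M : ℤ → Matrix (suc m)
  tI-M t i k = scalar t i k - M i k
  rest : ℤ → ℤ
  rest t = sumFin m (λ j → sign (suc j) * ((+ 0 - M zero (suc j)) * det m (minor (tI-M t) (suc j))))
  rest-poly : ∃ λ ℓ → Poly m ℓ rest
  rest-poly = poly-sumFin m _ λ j →
    let _ , minor-poly = poly-det m (λ t → minor (tI-M t) (suc j))
                           (λ i k → poly-entry (suc i) (punchIn (suc j) k) (M (suc i) (punchIn (suc j) k)))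
    in _ , poly-scale (sign (suc j)) (poly-* (const (+ 0 - M zero (suc j)) (λ _ → refl)) minor-poly)
  minor-monic : Poly m (+ 1) (χ (minor M zero))
  minor-monic = χ-monic m (minor M zero)
  regroup : ∀ t c g r → t * g + (r + - c * g) ≡ + 1 * ((t - c) * g) + r
  regroup = solve-∀
  expansion : ∀ t → t * χ (minor M zero) t + (rest t + - M zero zero * χ (minor M zero) t) ≡ χ M t
  expansion t = trans (regroup t (M zero zero) (χ (minor M zero) t) (rest t))
                      (cong (λ d → + 1 * ((t - M zero zero) * d) + rest t)
                            (det-cong m (λ i k → cong (_- M (suc i) (suc k)) (sym (scalar-suc t i k)))))

-- Polynomials splitting into integer linear factors

Splits : ℕ → (ℤ → ℤ) → Set
Splits n f = ∃ λ (roots : Fin n → ℤ) → ∀ t → f t ≡ prodFin n (λ i → t - roots i)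

splits-cong : ∀ {n f g} → (∀ t → f t ≡ g t) → Splits n f → Splits n g
splits-cong f≗g (roots , f≡) = roots , λ t → trans (sym (f≗g t)) (f≡ t)

splits-* : ∀ {a b f g} → Splits a f → Splits b g → Splits (a +ℕ b) (λ t → f t * g t)
splits-* {a} {b} {f} {g} (r , f≡) (s , g≡) = r ++ s , λ t → begin
  f t * g t                                                        ≡⟨ cong₂ _*_ (f≡ t) (g≡ t) ⟩
  prodFin a (λ i → t - r i) * prodFin b (λ i → t - s i)
    ≡⟨ cong₂ _*_ (prodFin-cong a (λ i → cong (λ u → t - [ r , s ] u) (splitAt-↑ˡ a i b)))
                 (prodFin-cong b (λ i → cong (λ u → t - [ r , s ] u) (splitAt-↑ʳ a b i))) ⟨
  prodFin a (λ i → t - (r ++ s) (i ↑ˡ b)) * prodFin b (λ i → t - (r ++ s) (a ↑ʳ i))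
    ≡⟨ prodFin-↑ a b (λ i → t - (r ++ s) i) ⟨
  prodFin (a +ℕ b) (λ i → t - (r ++ s) i)                          ∎
  where open ≡-Reasoning

splits-reflect : ∀ {n f} → Splits n f → Splits n (λ t → -1ℤ ^ n * f (- t))
splits-reflect {n} (r , f≡) = (λ i → - r i) , λ t → trans (cong (-1ℤ ^ n *_) (f≡ (- t))) (reflect n r t)
  where
  reflect : ∀ n (r : Fin n → ℤ) t → -1ℤ ^ n * prodFin n (λ i → - t - r i) ≡ prodFin n (λ i → t - - r i)
  reflect zero    r t = refl
  reflect (suc n) r t = trans (regroup (-1ℤ ^ n) t (r zero) (prodFin n (λ i → - t - r (suc i))))
                              (cong ((t - - r zero) *_) (reflect n (r ∘ suc) t))
    where
    regroup : ∀ s t x p → (-1ℤ * s) * ((- t - x) * p) ≡ (t - - x) * (s * p)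
    regroup = solve-∀

splits-monicFactor : ∀ N {a b p q} → a +ℕ b ≡ N → Poly a (+ 1) p → Poly b (+ 1) q →
                     ∀ (μ : Fin N → ℤ) → (∀ t → p t * q t ≡ prodFin N (λ j → t - μ j)) → Splits a p
splits-monicFactor zero {zero} refl p-monic _ _ _ = (λ ()) , monic-degree-zero p-monic
splits-monicFactor (suc N) {a} {b} {p} {q} a+b≡1+N p-monic q-monic μ pq≡ =
  [ divide-p a+b≡1+N p-monic , divide-q a+b≡1+N q-monic ]
    (i*j≡0⇒i≡0∨j≡0 (p μ₀) (trans (pq≡ μ₀) μ₀-root))
  where
  μ₀ : ℤ
  μ₀ = μ zero
  μ₀-root : prodFin (suc N) (λ j → μ₀ - μ j) ≡ + 0
  μ₀-root = trans (cong (_* prodFin N (λ j → μ₀ - μ (suc j))) (+-inverseʳ μ₀))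
                  (*-zeroˡ (prodFin N (λ j → μ₀ - μ (suc j))))
  cancel-μ₀ : ∀ {d ℓ f} → Poly d ℓ f → d ≡ N → (∀ t → (t - μ₀) * f t ≡ p t * q t) →
              ∀ t → f t ≡ prodFin N (λ j → t - μ (suc j))
  cancel-μ₀ f-poly refl f≡ = poly-cancel f-poly (poly-prodFin N (μ ∘ suc)) μ₀ (λ t → trans (f≡ t) (pq≡ t))
  divide-p : ∀ {a} → a +ℕ b ≡ suc N → Poly a (+ 1) p → p μ₀ ≡ + 0 → Splits a p
  divide-p {zero}   _  p-monic p-root = ⊥-elim (monic-degree-zero-no-root p-monic p-root)
  divide-p {suc a′} eq p-monic p-root =
    let p′ , p′-monic , p≡ = poly-divide p-monic p-root
        p′q≡ = cancel-μ₀ (poly-* p′-monic q-monic) (ℕ.suc-injective eq)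
                         (λ t → trans (sym (*-assoc (t - μ₀) (p′ t) (q t))) (cong (_* q t) (sym (p≡ t))))
        roots , p′≡ = splits-monicFactor N (ℕ.suc-injective eq) p′-monic q-monic (μ ∘ suc) p′q≡
    in (μ₀ ∷ roots) , λ t → trans (p≡ t) (cong ((t - μ₀) *_) (p′≡ t))
  divide-q : ∀ {b} → a +ℕ b ≡ suc N → Poly b (+ 1) q → q μ₀ ≡ + 0 → Splits a p
  divide-q {zero}   _  q-monic q-root = ⊥-elim (monic-degree-zero-no-root q-monic q-root)
  divide-q {suc b′} eq q-monic q-root =
    let q′ , q′-monic , q≡ = poly-divide q-monic q-root
        a+b′≡N = ℕ.suc-injective (trans (sym (ℕ.+-suc a b′)) eq)
        pq′≡ = cancel-μ₀ (poly-* p-monic q′-monic) a+b′≡N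
                         (λ t → trans (rotate (t - μ₀) (p t) (q′ t)) (cong (p t *_) (sym (q≡ t))))
    in splits-monicFactor N a+b′≡N p-monic q′-monic (μ ∘ suc) pq′≡
    where
    rotate : ∀ x y z → x * (y * z) ≡ y * (x * z)
    rotate = solve-∀

integral-D : ∀ {n} (G : Graph n) → Integral G ⇔ Integral (D G)
integral-D {n} G = mk⇔ to from
  where
  χA χ-A : ℤ → ℤ
  χA = χ (A G)
  χ-A = χ (λ a b → - A G a b)
  to : Splits n (charPoly G) → Splits (n +ℕ n) (charPoly (D G))
  to G-splits = splits-cong (λ t → sym (charPoly-D G t))
    (splits-* χA-splits (splits-cong (λ t → sym (χ-neg n (A G) t)) (splits-reflect χA-splits)))
    where
    χA-splits : Splits n χA
    χA-splits = splits-cong (charPoly≡χ G) G-splits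
  from : Splits (n +ℕ n) (charPoly (D G)) → Splits n (charPoly G)
  from (μ , DG≡) = splits-cong (λ t → sym (charPoly≡χ G t))
    (splits-monicFactor (n +ℕ n) refl (χ-monic n (A G)) (χ-monic n (λ a b → - A G a b)) μ
                        (λ t → trans (sym (charPoly-D G t)) (DG≡ t)))

integral-Dᵐ : ∀ {n} (G : Graph n) m → Integral G ⇔ Integral (Dᵐ m G)
integral-Dᵐ G zero    = ⇔-refl
integral-Dᵐ G (suc m) = ⇔-trans (integral-D G) (integral-Dᵐ (D G) m)

mainTheorem15 : ∀ {n} (G : Graph n) (m : ℕ) → 1 ≤ m → (Integral G ⇔ Integral (Dᵐ m G))
mainTheorem15 G m _ = integral-Dᵐ G m
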